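{- For every positive integer $N$, $$\sum_{n=1}^N H_n=(N+1)(H_{N+1}-1),\qquad \sum_{n=1}^N H_n^2=(N+1)H_{N+1}^2-(2N+3)H_{N+1}+2N+2 .$$ Moreover, for every integer $M\ge3$, as $N\to\infty$, $$\begin{aligned}\sum_{n=1}^N H_n^M={}&(N+1)H_{N+1}^M+(-1)^M M!\Bigg\{\sum_{m=3}^{M-1}\frac{(-1)^m}{m!}H_{N+1}^m\left(N+\tfrac32\right)+N+1+\left(\tfrac N2+\tfrac34\right)H_{N+1}^2-\left(N+\tfrac32\right)H_{N+1}\\&-\sum_{m=3}^M\frac{\zeta(m-1)}{m!}\left(\frac m2-1\right)+\sum_{m=4}^M\frac1{m!}\sum_{k=1}^{m-3}\left[\binom{m-1}{k}\frac m2-\binom mk\right](-1)^{k+1}\mathcal{H}^k(m-k-1)\Bigg\}+o(1).\end{aligned}$$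
   Context: $H_n=1+\frac12+\cdots+\frac1n$; $\zeta$ is the Riemann zeta function; for integers $k\ge1$, $\mathcal{H}^k(s)=\sum_{n\ge1}H_n^k n^{ -s}$ (convergent for $\Re(s)>1$; here evaluated at integers $\ge2$). Empty sums are $0$. $o(1)$ denotes a quantity tending to $0$ as $N\to\infty$. -}

module Defs where

open import Data.Nat as ℕ using (ℕ; zero; suc; _≤ᵇ_; _!)
open import Data.Nat.Combinatorics using (_C_)
open import Data.Integer using (+_)
open import Data.Rational using (ℚ; 0ℚ; 1ℚ; _+_; _*_; _-_; -_; _/_)
open import Data.Bool using (if_then_else_)
open import Data.Nat.Properties using (_!≢0)

ℚof : ℕ → ℚ
ℚof n = + n / 1

_^ℚ_ : ℚ → ℕ → ℚ
q ^ℚ zero = 1ℚ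
q ^ℚ suc k = q * (q ^ℚ k)

infixr 8 _^ℚ_

sumTo : ℕ → (ℕ → ℚ) → ℚ
sumTo zero f = 0ℚ
sumTo (suc N) f = sumTo N f + f (suc N)

-- Σ_{n=a}^{b} f n  (empty, i.e. 0, when b < a; indices start at 1)
sumFT : ℕ → ℕ → (ℕ → ℚ) → ℚ
sumFT a b f = sumTo b (λ n → if a ≤ᵇ n then f n else 0ℚ)

H : ℕ → ℚ
H zero = 0ℚ
H (suc n) = H n + (+ 1 / suc n)

invPow : ℕ → ℕ → ℚ
invPow zero s = 0ℚ
invPow (suc n) s = (+ 1 / suc n) ^ℚ s

zetaPartial : ℕ → ℕ → ℚ
zetaPartial s L = sumTo L (λ n → invPow n s)

-- partial sums of 𝓗^k(s):  Σ_{n=1}^{L} H_n^k n^{-s}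
HkPartial : ℕ → ℕ → ℕ → ℚ
HkPartial k s L = sumTo L (λ n → (H n ^ℚ k) * invPow n s)

invFact : ℕ → ℚ
invFact m = _/_ (+ 1) (m !) {{m !≢0}}

sgn : ℕ → ℚ
sgn k = (- 1ℚ) ^ℚ k

-- The curly bracket {…} of Theorem 13 for exponent M and index N, where
-- ζ(s) and 𝓗^k(s) are replaced by their partial sums up to L.
bracket : ℕ → ℕ → ℕ → ℚ
bracket M N L =
  sumFT 3 (M ℕ.∸ 1) (λ m → sgn m * invFact m * (h ^ℚ m) * (ℚof N + + 3 / 2))
  + ℚof (suc N)
  + (ℚof N * (+ 1 / 2) + + 3 / 4) * (h ^ℚ 2)
  - (ℚof N + + 3 / 2) * h
  - sumFT 3 M (λ m → zetaPartial (m ℕ.∸ 1) L * invFact m * (+ m / 2 - 1ℚ))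
  + sumFT 4 M (λ m → invFact m *
      sumFT 1 (m ℕ.∸ 3) (λ k →
        (ℚof ((m ℕ.∸ 1) C k) * (+ m / 2) - ℚof (m C k))
        * sgn (suc k) * HkPartial k (m ℕ.∸ k ℕ.∸ 1) L))
  where
  h = H (suc N)

rhsM : ℕ → ℕ → ℕ → ℚ
rhsM M N L = ℚof (suc N) * (H (suc N) ^ℚ M) + sgn M * ℚof (M !) * bracket M N L

{-# OPTIONS --safe #-}

-- With ζ(s) and 𝓗^k(s) truncated at L = N + 1 the formula for Σ H_n^M is an exact identity.
-- Raising N by one adds t = 1/(N + 2) to H (N + 1), and the right-hand side then grows by exactly
-- H (N + 1) ^ M: a polynomial identity in N, H (N + 1) and t modulo (N + 2) t = 1, proved by
-- induction on M, once the inner sums over k are evaluated by the binomial theorem at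
-- (- H (N + 2)) + t = - H (N + 1). The cases M = 1, 2 are the same telescoping without series.
-- The o(1) thus comes only from the tails of the series. For s ≥ 2, H (N + 1) times the tail of
-- 𝓗^k(s) beyond N + 1 is at most a partial sum of 𝓗^(k+1)(s), and these are bounded (summation
-- by parts against 1/n - 1/(n+1)); since H (2 ^ p) ≥ p/2, the tails are o(1).
module Submission where

open import Algebra.Bundles using (CommutativeMonoid; CommutativeRing; CommutativeSemiring)
import Algebra.Definitions.RawSemiring as RawSemiring
import Algebra.Properties.CommutativeSemiring.Binomial as Binomial
open import Data.Bool using (Bool; true; false; if_then_else_)
open import Data.Fin as Fin using (Fin; toℕ)
open import Data.Integer as ℤ using (+_; -[1+_])
import Data.Integer.Properties as ℤ
import Data.Integer.Tactic.RingSolver as ℤ-Solver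
open import Data.Nat as ℕ using (ℕ; zero; suc; _!)
open import Data.Nat.Combinatorics using (_C_; k>n⇒nCk≡0; nCk+nC[k+1]≡[n+1]C[k+1]; nCn≡1; nC1≡n; nCk≡nC[n∸k])
import Data.Nat.Properties as ℕ
import Data.Nat.Tactic.RingSolver as ℕ-Solver
open import Data.Product using (∃-syntax; _×_; _,_; proj₁; proj₂)
open import Data.Rational
open import Data.Rational.Properties
open import Algebra.Properties.CommutativeSemigroup (CommutativeMonoid.commutativeSemigroup *-1-commutativeMonoid)
  using (x∙yz≈y∙xz)
import Data.Rational.Unnormalised as ℚᵘ
import Data.Rational.Unnormalised.Properties as ℚᵘ
open import Function using (_∘_)
open import Level using (0ℓ)
open import Relation.Binary.PropositionalEquality
open import Relation.Nullary.Decidable.Core using (dec⇒maybe)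
import Tactic.RingSolver.Core.AlmostCommutativeRing as ACR
open import Tactic.RingSolver using (solve-∀)

open import Defs

ℚ-ring : ACR.AlmostCommutativeRing 0ℓ 0ℓ
ℚ-ring = ACR.fromCommutativeRing +-*-commutativeRing (λ x → dec⇒maybe (0ℚ ≟ x))

toℚᵘ-ℚof : ∀ n → toℚᵘ (ℚof n) ℚᵘ.≃ ℚᵘ.mkℚᵘ (+ n) 0
toℚᵘ-ℚof n = toℚᵘ-fromℚᵘ (ℚᵘ.mkℚᵘ (+ n) 0)

ℚof-+ : ∀ m n → ℚof (m ℕ.+ n) ≡ ℚof m + ℚof n
ℚof-+ m n = toℚᵘ-injective (begin
  toℚᵘ (ℚof (m ℕ.+ n))                       ≈⟨ toℚᵘ-ℚof (m ℕ.+ n) ⟩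
  ℚᵘ.mkℚᵘ (+ (m ℕ.+ n)) 0                    ≈⟨ ℚᵘ.*≡* cross ⟩
  ℚᵘ.mkℚᵘ (+ m) 0 ℚᵘ.+ ℚᵘ.mkℚᵘ (+ n) 0       ≈⟨ ℚᵘ.+-cong (toℚᵘ-ℚof m) (toℚᵘ-ℚof n) ⟨
  toℚᵘ (ℚof m) ℚᵘ.+ toℚᵘ (ℚof n)             ≈⟨ toℚᵘ-homo-+ (ℚof m) (ℚof n) ⟨
  toℚᵘ (ℚof m + ℚof n)                       ∎)
  where
  open ℚᵘ.≃-Reasoning
  cross : + (m ℕ.+ n) ℤ.* + 1 ≡ (+ m ℤ.* + 1 ℤ.+ + n ℤ.* + 1) ℤ.* + 1
  cross = trans (cong (ℤ._* + 1) (ℤ.pos-+ m n)) (unit-denominators (+ m) (+ n))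
    where
    unit-denominators : ∀ a b → (a ℤ.+ b) ℤ.* + 1 ≡ (a ℤ.* + 1 ℤ.+ b ℤ.* + 1) ℤ.* + 1
    unit-denominators = ℤ-Solver.solve-∀

ℚof-* : ∀ m n → ℚof (m ℕ.* n) ≡ ℚof m * ℚof n
ℚof-* m n = toℚᵘ-injective (begin
  toℚᵘ (ℚof (m ℕ.* n))                       ≈⟨ toℚᵘ-ℚof (m ℕ.* n) ⟩
  ℚᵘ.mkℚᵘ (+ (m ℕ.* n)) 0                    ≈⟨ ℚᵘ.*≡* cross ⟩
  ℚᵘ.mkℚᵘ (+ m) 0 ℚᵘ.* ℚᵘ.mkℚᵘ (+ n) 0       ≈⟨ ℚᵘ.*-cong (toℚᵘ-ℚof m) (toℚᵘ-ℚof n) ⟨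
  toℚᵘ (ℚof m) ℚᵘ.* toℚᵘ (ℚof n)             ≈⟨ toℚᵘ-homo-* (ℚof m) (ℚof n) ⟨
  toℚᵘ (ℚof m * ℚof n)                       ∎)
  where
  open ℚᵘ.≃-Reasoning
  cross : + (m ℕ.* n) ℤ.* + 1 ≡ (+ m ℤ.* + n) ℤ.* + 1
  cross = cong (ℤ._* + 1) (ℤ.pos-* m n)

ℚof-suc : ∀ n → ℚof (suc n) ≡ ℚof n + 1ℚ
ℚof-suc n = trans (ℚof-+ 1 n) (+-comm 1ℚ (ℚof n))

a/n*n≡a : ∀ a n .{{_ : ℕ.NonZero n}} → (+ a / n) * ℚof n ≡ ℚof a
a/n*n≡a a n@(suc d) = toℚᵘ-injective (begin
  toℚᵘ (+ a / n * ℚof n)                     ≈⟨ toℚᵘ-homo-* (+ a / n) (ℚof n) ⟩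
  toℚᵘ (+ a / n) ℚᵘ.* toℚᵘ (ℚof n)           ≈⟨ ℚᵘ.*-cong (toℚᵘ-fromℚᵘ (ℚᵘ.mkℚᵘ (+ a) d)) (toℚᵘ-ℚof n) ⟩
  ℚᵘ.mkℚᵘ (+ a) d ℚᵘ.* ℚᵘ.mkℚᵘ (+ n) 0       ≈⟨ ℚᵘ.*≡* cross ⟩
  ℚᵘ.mkℚᵘ (+ a) 0                            ≈⟨ toℚᵘ-ℚof a ⟨
  toℚᵘ (ℚof a)                               ∎)
  where
  open ℚᵘ.≃-Reasoning
  cross : (+ a ℤ.* + n) ℤ.* + 1 ≡ + a ℤ.* (+ n ℤ.* + 1)
  cross = reassociate (+ a) (+ n)
    where
    reassociate : ∀ a b → (a ℤ.* b) ℤ.* + 1 ≡ a ℤ.* (b ℤ.* + 1)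
    reassociate = ℤ-Solver.solve-∀

m/2≡m*½ : ∀ m → + m / 2 ≡ ℚof m * (+ 1 / 2)
m/2≡m*½ m = begin
  + m / 2                            ≡⟨ split-off-2 (+ m / 2) ⟩
  (+ m / 2 * ℚof 2) * (+ 1 / 2)      ≡⟨ cong (_* (+ 1 / 2)) (a/n*n≡a m 2) ⟩
  ℚof m * (+ 1 / 2)                  ∎
  where
  open ≡-Reasoning
  split-off-2 : ∀ x → x ≡ (x * ℚof 2) * (+ 1 / 2)
  split-off-2 = solve-∀ ℚ-ring

invFact*m!≡1 : ∀ m → invFact m * ℚof (m !) ≡ 1ℚ
invFact*m!≡1 m = a/n*n≡a 1 (m !) {{m ℕ.!≢0}}

invFact[1+m]*[1+m]≡invFact : ∀ m → invFact (suc m) * ℚof (suc m) ≡ invFact m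
invFact[1+m]*[1+m]≡invFact m = begin
  a * n                      ≡⟨ *-identityʳ (a * n) ⟨
  a * n * 1ℚ                 ≡⟨ cong (a * n *_) (invFact*m!≡1 m) ⟨
  a * n * (f * F)            ≡⟨ regroup a n f F ⟩
  (a * (n * F)) * f          ≡⟨ cong (λ z → a * z * f) (ℚof-* (suc m) (m !)) ⟨
  (a * ℚof (suc m !)) * f    ≡⟨ cong (_* f) (invFact*m!≡1 (suc m)) ⟩
  1ℚ * f                     ≡⟨ *-identityˡ f ⟩
  f                          ∎
  where
  open ≡-Reasoning
  a = invFact (suc m)
  n = ℚof (suc m)
  f = invFact m
  F = ℚof (m !)
  regroup : ∀ a n f F → a * n * (f * F) ≡ (a * (n * F)) * f
  regroup = solve-∀ ℚ-ring

sgn*sgn≡1 : ∀ m → sgn m * sgn m ≡ 1ℚ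
sgn*sgn≡1 zero    = refl
sgn*sgn≡1 (suc m) = trans (signs-cancel (sgn m)) (sgn*sgn≡1 m)
  where
  signs-cancel : ∀ s → (- 1ℚ * s) * (- 1ℚ * s) ≡ s * s
  signs-cancel = solve-∀ ℚ-ring

[-x]^k≡sgn*x^k : ∀ x k → (- x) ^ℚ k ≡ sgn k * x ^ℚ k
[-x]^k≡sgn*x^k x zero    = refl
[-x]^k≡sgn*x^k x (suc k) = trans (cong (- x *_) ([-x]^k≡sgn*x^k x k)) (regroup x (sgn k) (x ^ℚ k))
  where
  regroup : ∀ x s p → (- x) * (s * p) ≡ (- 1ℚ * s) * (x * p)
  regroup = solve-∀ ℚ-ring

1^r≡1 : ∀ r → 1ℚ ^ℚ r ≡ 1ℚ
1^r≡1 zero    = refl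
1^r≡1 (suc r) = trans (*-identityˡ (1ℚ ^ℚ r)) (1^r≡1 r)

p≤q⇒0≤q-p : ∀ {p q} → p ≤ q → 0ℚ ≤ q - p
p≤q⇒0≤q-p {p} {q} p≤q = subst (_≤ q - p) (+-inverseʳ p) (+-monoˡ-≤ (- p) p≤q)

0≤q-p⇒p≤q : ∀ {p q} → 0ℚ ≤ q - p → p ≤ q
0≤q-p⇒p≤q {p} {q} 0≤q-p = subst₂ _≤_ (+-identityʳ p) (p+[q-p]≡q p q) (+-monoʳ-≤ p 0≤q-p)
  where
  p+[q-p]≡q : ∀ p q → p + (q - p) ≡ q
  p+[q-p]≡q = solve-∀ ℚ-ring

0≤p*q : ∀ {p q} → 0ℚ ≤ p → 0ℚ ≤ q → 0ℚ ≤ p * q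
0≤p*q {p} {q} 0≤p 0≤q = nonNegative⁻¹ (p * q) {{nonNeg*nonNeg⇒nonNeg p {{nonNegative 0≤p}} q {{nonNegative 0≤q}}}}

p≤p+q : ∀ {p q} → 0ℚ ≤ q → p ≤ p + q
p≤p+q {p} {q} 0≤q = subst (_≤ p + q) (+-identityʳ p) (+-monoʳ-≤ p 0≤q)

*-monoˡ-≤-0≤ : ∀ {r} → 0ℚ ≤ r → ∀ {p q} → p ≤ q → r * p ≤ r * q
*-monoˡ-≤-0≤ {r} 0≤r = *-monoˡ-≤-nonNeg r {{nonNegative 0≤r}}

*-monoʳ-≤-0≤ : ∀ {r} → 0ℚ ≤ r → ∀ {p q} → p ≤ q → p * r ≤ q * r
*-monoʳ-≤-0≤ {r} 0≤r = *-monoʳ-≤-nonNeg r {{nonNegative 0≤r}}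

0≤ℚof : ∀ n → 0ℚ ≤ ℚof n
0≤ℚof n = nonNegative⁻¹ (ℚof n) {{normalize-nonNeg n 1}}

ℚof-mono-≤ : ∀ {m n} → m ℕ.≤ n → ℚof m ≤ ℚof n
ℚof-mono-≤ {m} {n} m≤n = 0≤q-p⇒p≤q (subst (0ℚ ≤_) (sym difference) (0≤ℚof (n ℕ.∸ m)))
  where
  open ≡-Reasoning
  p+q-p≡q : ∀ p q → p + q - p ≡ q
  p+q-p≡q = solve-∀ ℚ-ring
  difference : ℚof n - ℚof m ≡ ℚof (n ℕ.∸ m)
  difference = begin
    ℚof n - ℚof m                       ≡⟨ cong (λ k → ℚof k - ℚof m) (ℕ.m+[n∸m]≡n m≤n) ⟨
    ℚof (m ℕ.+ (n ℕ.∸ m)) - ℚof m       ≡⟨ cong (_- ℚof m) (ℚof-+ m (n ℕ.∸ m)) ⟩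
    ℚof m + ℚof (n ℕ.∸ m) - ℚof m       ≡⟨ p+q-p≡q (ℚof m) (ℚof (n ℕ.∸ m)) ⟩
    ℚof (n ℕ.∸ m)                       ∎

ℚof<ℚof[1+n] : ∀ n → ℚof n < ℚof (suc n)
ℚof<ℚof[1+n] n = subst₂ _<_ (+-identityʳ (ℚof n)) (sym (ℚof-suc n)) (+-monoʳ-< (ℚof n) (positive⁻¹ 1ℚ))

ℚof-positive : ∀ {n} → 0 ℕ.< n → Positive (ℚof n)
ℚof-positive {suc n} _ = normalize-pos (suc n) 1

0≤^ : ∀ {x} r → 0ℚ ≤ x → 0ℚ ≤ x ^ℚ r
0≤^ zero    0≤x = nonNegative⁻¹ 1ℚ
0≤^ (suc r) 0≤x = 0≤p*q 0≤x (0≤^ r 0≤x)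

^≤1 : ∀ {x} r → 0ℚ ≤ x → x ≤ 1ℚ → x ^ℚ r ≤ 1ℚ
^≤1     zero    0≤x x≤1 = ≤-refl
^≤1 {x} (suc r) 0≤x x≤1 = ≤-trans (*-monoˡ-≤-0≤ 0≤x (^≤1 r 0≤x x≤1)) (subst (_≤ 1ℚ) (sym (*-identityʳ x)) x≤1)

^-mono-≤ : ∀ {x y} r → 0ℚ ≤ y → y ≤ x → y ^ℚ r ≤ x ^ℚ r
^-mono-≤ zero _ _ = ≤-refl
^-mono-≤ {x} {y} (suc r) 0≤y y≤x = 0≤q-p⇒p≤q (subst (0ℚ ≤_) (sym (split x y (x ^ℚ r) (y ^ℚ r)))
  (+-mono-≤ (0≤p*q (≤-trans 0≤y y≤x) (p≤q⇒0≤q-p (^-mono-≤ r 0≤y y≤x))) (0≤p*q (p≤q⇒0≤q-p y≤x) (0≤^ r 0≤y))))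
  where
  split : ∀ x y X Y → x * X - y * Y ≡ x * (X - Y) + (x - y) * Y
  split = solve-∀ ℚ-ring

x^[1+r]-y^[1+r]≤[1+r]*x^r*[x-y] : ∀ {x y} r → 0ℚ ≤ y → y ≤ x →
  x ^ℚ suc r - y ^ℚ suc r ≤ ℚof (suc r) * x ^ℚ r * (x - y)
x^[1+r]-y^[1+r]≤[1+r]*x^r*[x-y] {x} {y} zero 0≤y y≤x = ≤-reflexive (linear x y)
  where
  linear : ∀ x y → x * 1ℚ - y * 1ℚ ≡ 1ℚ * 1ℚ * (x - y)
  linear = solve-∀ ℚ-ring
x^[1+r]-y^[1+r]≤[1+r]*x^r*[x-y] {x} {y} (suc r) 0≤y y≤x = 0≤q-p⇒p≤q (subst (0ℚ ≤_) (sym gap)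
  (+-mono-≤ (0≤p*q 0≤x (p≤q⇒0≤q-p (x^[1+r]-y^[1+r]≤[1+r]*x^r*[x-y] r 0≤y y≤x)))
            (0≤p*q (p≤q⇒0≤q-p y≤x) (p≤q⇒0≤q-p (^-mono-≤ (suc r) 0≤y y≤x)))))
  where
  0≤x = ≤-trans 0≤y y≤x
  X = x ^ℚ r
  Y = y ^ℚ r
  split : ∀ n x y X Y → (n + 1ℚ) * (x * X) * (x - y) - (x * (x * X) - y * (y * Y))
    ≡ x * (n * X * (x - y) - (x * X - y * Y)) + (x - y) * (x * X - y * Y)
  split = solve-∀ ℚ-ring
  gap : ℚof (suc (suc r)) * (x * X) * (x - y) - (x * (x * X) - y * (y * Y))
    ≡ x * (ℚof (suc r) * X * (x - y) - (x * X - y * Y)) + (x - y) * (x * X - y * Y)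
  gap = trans (cong (λ n → n * (x * X) * (x - y) - (x * (x * X) - y * (y * Y))) (ℚof-suc (suc r))) (split (ℚof (suc r)) x y X Y)

sumTo-cong : ∀ N {f g : ℕ → ℚ} → (∀ i → i ℕ.< N → f (suc i) ≡ g (suc i)) → sumTo N f ≡ sumTo N g
sumTo-cong zero    f≡g = refl
sumTo-cong (suc N) f≡g = cong₂ _+_ (sumTo-cong N (λ i i<N → f≡g i (ℕ.m<n⇒m<1+n i<N))) (f≡g N (ℕ.n<1+n N))

sumTo-zero : ∀ N {f : ℕ → ℚ} → (∀ i → f (suc i) ≡ 0ℚ) → sumTo N f ≡ 0ℚ
sumTo-zero zero    f≡0 = refl
sumTo-zero (suc N) f≡0 = trans (cong₂ _+_ (sumTo-zero N f≡0) (f≡0 N)) (+-identityʳ 0ℚ)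

sumTo-+ : ∀ N (f g : ℕ → ℚ) → sumTo N (λ n → f n + g n) ≡ sumTo N f + sumTo N g
sumTo-+ zero    f g = refl
sumTo-+ (suc N) f g = trans (cong (_+ (f (suc N) + g (suc N))) (sumTo-+ N f g)) (+-interchange (sumTo N f) (sumTo N g) _ _)
  where
  +-interchange : ∀ a b c d → (a + b) + (c + d) ≡ (a + c) + (b + d)
  +-interchange = solve-∀ ℚ-ring

sumTo-*ˡ : ∀ N c (f : ℕ → ℚ) → sumTo N (λ n → c * f n) ≡ c * sumTo N f
sumTo-*ˡ zero    c f = sym (*-zeroʳ c)
sumTo-*ˡ (suc N) c f = trans (cong (_+ c * f (suc N)) (sumTo-*ˡ N c f)) (sym (*-distribˡ-+ c _ _))

sumTo-shift : ∀ N (f : ℕ → ℚ) → sumTo (suc N) f ≡ f 1 + sumTo N (f ∘ suc)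
sumTo-shift zero    f = +-comm 0ℚ (f 1)
sumTo-shift (suc N) f = trans (cong (_+ f (suc (suc N))) (sumTo-shift N f)) (+-assoc (f 1) _ _)

sum₀-linear : ∀ n c (f g : ℕ → ℚ) →
  (c * f 0 + g 0) + sumTo n (λ k → c * f k + g k) ≡ c * (f 0 + sumTo n f) + (g 0 + sumTo n g)
sum₀-linear n c f g = begin
  (c * f 0 + g 0) + sumTo n (λ k → c * f k + g k)          ≡⟨ cong (_+_ (c * f 0 + g 0)) (sumTo-+ n _ g) ⟩
  (c * f 0 + g 0) + (sumTo n (λ k → c * f k) + sumTo n g)  ≡⟨ cong (λ z → (c * f 0 + g 0) + (z + sumTo n g)) (sumTo-*ˡ n c f) ⟩
  (c * f 0 + g 0) + (c * sumTo n f + sumTo n g)            ≡⟨ regroup c (f 0) (g 0) (sumTo n f) (sumTo n g) ⟩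
  c * (f 0 + sumTo n f) + (g 0 + sumTo n g)                ∎
  where
  open ≡-Reasoning
  regroup : ∀ c a b F G → (c * a + b) + (c * F + G) ≡ c * (a + F) + (b + G)
  regroup = solve-∀ ℚ-ring

sumTo-telescoping : ∀ (a F : ℕ → ℚ) → F 0 ≡ 0ℚ → (∀ N → F (suc N) ≡ F N + a (suc N)) → ∀ N → sumTo N a ≡ F N
sumTo-telescoping a F F0≡0 step zero    = sym F0≡0
sumTo-telescoping a F F0≡0 step (suc N) = trans (cong (_+ a (suc N)) (sumTo-telescoping a F F0≡0 step N)) (sym (step N))

0≤sumTo : ∀ N {f : ℕ → ℚ} → (∀ n → 0ℚ ≤ f n) → 0ℚ ≤ sumTo N f
0≤sumTo zero    0≤f = ≤-refl
0≤sumTo (suc N) 0≤f = +-mono-≤ (0≤sumTo N 0≤f) (0≤f (suc N))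

if-+ : ∀ (c : Bool) x y → (if c then x + y else 0ℚ) ≡ (if c then x else 0ℚ) + (if c then y else 0ℚ)
if-+ true  x y = refl
if-+ false x y = sym (+-identityʳ 0ℚ)

if-0 : ∀ (c : Bool) {x} → x ≡ 0ℚ → (if c then x else 0ℚ) ≡ 0ℚ
if-0 true  x≡0 = x≡0
if-0 false x≡0 = refl

sumFT-cong : ∀ a b {f g : ℕ → ℚ} → (∀ i → f (suc i) ≡ g (suc i)) → sumFT a b f ≡ sumFT a b g
sumFT-cong a b f≡g = sumTo-cong b (λ i _ → cong (λ z → if a ℕ.≤ᵇ suc i then z else 0ℚ) (f≡g i))

sumFT-zero : ∀ a b {f : ℕ → ℚ} → (∀ i → f (suc i) ≡ 0ℚ) → sumFT a b f ≡ 0ℚ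
sumFT-zero a b f≡0 = sumTo-zero b (λ i → if-0 (a ℕ.≤ᵇ suc i) (f≡0 i))

sumFT-+ : ∀ a b (f g : ℕ → ℚ) → sumFT a b (λ n → f n + g n) ≡ sumFT a b f + sumFT a b g
sumFT-+ a b f g = trans (sumTo-cong b (λ i _ → if-+ (a ℕ.≤ᵇ suc i) (f (suc i)) (g (suc i)))) (sumTo-+ b _ _)

tailSum : ℕ → ℕ → (ℕ → ℚ) → ℚ
tailSum N zero    f = 0ℚ
tailSum N (suc d) f = tailSum N d f + f (2 ℕ.+ d ℕ.+ N)

sumTo-split : ∀ N d (f : ℕ → ℚ) → sumTo (suc d ℕ.+ N) f ≡ sumTo (suc N) f + tailSum N d f
sumTo-split N zero    f = sym (+-identityʳ (sumTo (suc N) f))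
sumTo-split N (suc d) f = trans (cong (_+ f (2 ℕ.+ d ℕ.+ N)) (sumTo-split N d f)) (+-assoc (sumTo (suc N) f) _ _)

0≤tailSum : ∀ N d {f : ℕ → ℚ} → (∀ n → 0ℚ ≤ f n) → 0ℚ ≤ tailSum N d f
0≤tailSum N zero    0≤f = ≤-refl
0≤tailSum N (suc d) 0≤f = +-mono-≤ (0≤tailSum N d 0≤f) (0≤f (2 ℕ.+ d ℕ.+ N))

tailSum-mono-≤ : ∀ N d {f g : ℕ → ℚ} → (∀ n → suc N ℕ.< n → f n ≤ g n) → tailSum N d f ≤ tailSum N d g
tailSum-mono-≤ N zero    f≤g = ≤-refl
tailSum-mono-≤ N (suc d) f≤g = +-mono-≤ (tailSum-mono-≤ N d f≤g) (f≤g (2 ℕ.+ d ℕ.+ N) (ℕ.s≤s (ℕ.s≤s (ℕ.m≤n+m N d))))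

tailSum-*ʳ : ∀ N d c (f : ℕ → ℚ) → tailSum N d f * c ≡ tailSum N d (λ n → f n * c)
tailSum-*ʳ N zero    c f = *-zeroˡ c
tailSum-*ʳ N (suc d) c f = trans (*-distribʳ-+ c (tailSum N d f) _) (cong (_+ f (2 ℕ.+ d ℕ.+ N) * c) (tailSum-*ʳ N d c f))

tailSum≤sumTo : ∀ N d {f : ℕ → ℚ} → (∀ n → 0ℚ ≤ f n) → tailSum N d f ≤ sumTo (suc d ℕ.+ N) f
tailSum≤sumTo N d {f} 0≤f = subst (tailSum N d f ≤_) (sym (sumTo-split N d f))
  (subst (_≤ sumTo (suc N) f + tailSum N d f) (+-identityˡ (tailSum N d f)) (+-monoˡ-≤ (tailSum N d f) (0≤sumTo (suc N) 0≤f)))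

-- The binomial theorem

ℚ-commutativeSemiring : CommutativeSemiring 0ℓ 0ℓ
ℚ-commutativeSemiring = CommutativeRing.commutativeSemiring +-*-commutativeRing

module ℚ-Semiring = RawSemiring (CommutativeSemiring.rawSemiring ℚ-commutativeSemiring)

^-≡-^ℚ : ∀ x n → x ℚ-Semiring.^ n ≡ x ^ℚ n
^-≡-^ℚ x zero    = refl
^-≡-^ℚ x (suc n) = cong (x *_) (^-≡-^ℚ x n)

×-≡-ℚof* : ∀ n x → n ℚ-Semiring.× x ≡ ℚof n * x
×-≡-ℚof* zero    x = sym (*-zeroˡ x)
×-≡-ℚof* (suc n) x = begin
  x + n ℚ-Semiring.× x      ≡⟨ cong (_+_ x) (×-≡-ℚof* n x) ⟩
  x + ℚof n * x             ≡⟨ distribute x (ℚof n) ⟩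
  (ℚof n + 1ℚ) * x          ≡⟨ cong (_* x) (ℚof-suc n) ⟨
  ℚof (suc n) * x           ∎
  where
  open ≡-Reasoning
  distribute : ∀ x n → x + n * x ≡ (n + 1ℚ) * x
  distribute = solve-∀ ℚ-ring

sum-≡-sumTo : ∀ n (g : Fin (suc n) → ℚ) (f : ℕ → ℚ) → (∀ k → g k ≡ f (toℕ k)) →
              ℚ-Semiring.sum g ≡ f 0 + sumTo n f
sum-≡-sumTo zero    g f g≡f = cong (_+ 0ℚ) (g≡f Fin.zero)
sum-≡-sumTo (suc n) g f g≡f = begin
  g Fin.zero + ℚ-Semiring.sum (g ∘ Fin.suc)   ≡⟨ cong₂ _+_ (g≡f Fin.zero) (sum-≡-sumTo n (g ∘ Fin.suc) (f ∘ suc) (g≡f ∘ Fin.suc)) ⟩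
  f 0 + (f 1 + sumTo n (f ∘ suc))             ≡⟨ cong (_+_ (f 0)) (sumTo-shift n f) ⟨
  f 0 + sumTo (suc n) f                       ∎
  where open ≡-Reasoning

binomialTerm : ℕ → ℚ → ℚ → ℕ → ℚ
binomialTerm n x y k = ℚof (n C k) * (x ^ℚ k * y ^ℚ (n ℕ.∸ k))

binomial-theorem : ∀ n x y → (x + y) ^ℚ n ≡ binomialTerm n x y 0 + sumTo n (binomialTerm n x y)
binomial-theorem n x y = begin
  (x + y) ^ℚ n                              ≡⟨ ^-≡-^ℚ (x + y) n ⟨
  (x + y) ℚ-Semiring.^ n                    ≡⟨ Binomial.theorem ℚ-commutativeSemiring n x y ⟩
  Binomial.binomialExpansion ℚ-commutativeSemiring x y n
    ≡⟨ sum-≡-sumTo n _ (binomialTerm n x y) term ⟩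
  binomialTerm n x y 0 + sumTo n (binomialTerm n x y) ∎
  where
  open ≡-Reasoning
  term : ∀ k → Binomial.binomialTerm ℚ-commutativeSemiring x y n k ≡ binomialTerm n x y (toℕ k)
  term k = trans (×-≡-ℚof* (n C toℕ k) _) (cong (ℚof (n C toℕ k) *_) (cong₂ _*_ (^-≡-^ℚ x (toℕ k)) (^-≡-^ℚ y (n ℕ.∸ toℕ k))))

binomial-theorem-shifted : ∀ n a b →
  let f = λ k → ℚof (n C k) * (a ^ℚ k * b ^ℚ (suc n ℕ.∸ k)) in
  f 0 + sumTo (suc n) f ≡ b * (a + b) ^ℚ n
binomial-theorem-shifted n a b = begin
  f 0 + (sumTo n f + f (suc n))     ≡⟨ cong (λ z → f 0 + (sumTo n f + z)) top-vanishes ⟩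
  f 0 + (sumTo n f + 0ℚ)            ≡⟨ cong (_+_ (f 0)) (+-identityʳ (sumTo n f)) ⟩
  f 0 + sumTo n f                   ≡⟨ cong₂ _+_ (pull-out-b 0 ℕ.z≤n) (sumTo-cong n (λ i i<n → pull-out-b (suc i) i<n)) ⟩
  b * g 0 + sumTo n (λ k → b * g k) ≡⟨ cong (_+_ (b * g 0)) (sumTo-*ˡ n b g) ⟩
  b * g 0 + b * sumTo n g           ≡⟨ *-distribˡ-+ b (g 0) (sumTo n g) ⟨
  b * (g 0 + sumTo n g)             ≡⟨ cong (b *_) (binomial-theorem n a b) ⟨
  b * (a + b) ^ℚ n                  ∎
  where
  open ≡-Reasoning
  f g : ℕ → ℚ
  f k = ℚof (n C k) * (a ^ℚ k * b ^ℚ (suc n ℕ.∸ k))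
  g = binomialTerm n a b
  top-vanishes : f (suc n) ≡ 0ℚ
  top-vanishes = trans (cong (λ c → ℚof c * (a ^ℚ suc n * b ^ℚ (suc n ℕ.∸ suc n))) (k>n⇒nCk≡0 (ℕ.n<1+n n)))
                       (*-zeroˡ (a ^ℚ suc n * b ^ℚ (suc n ℕ.∸ suc n)))
  pull-out-b : ∀ k → k ℕ.≤ n → f k ≡ b * g k
  pull-out-b k k≤n = trans (cong (λ e → ℚof (n C k) * (a ^ℚ k * b ^ℚ e)) (ℕ.+-∸-assoc 1 k≤n))
                           (regroup (ℚof (n C k)) (a ^ℚ k) b (b ^ℚ (n ℕ.∸ k)))
    where
    regroup : ∀ c p b q → c * (p * (b * q)) ≡ b * (c * (p * q))
    regroup = solve-∀ ℚ-ring

[1+n]Cn≡1+n : ∀ n → suc n C n ≡ suc n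
[1+n]Cn≡1+n n = begin
  suc n C n               ≡⟨ nCk≡nC[n∸k] (ℕ.n≤1+n n) ⟩
  suc n C (suc n ℕ.∸ n)   ≡⟨ cong (suc n C_) (ℕ.m+n∸n≡m 1 n) ⟩
  suc n C 1               ≡⟨ nC1≡n (suc n) ⟩
  suc n                   ∎
  where open ≡-Reasoning

2*[1+n]C2≡[1+n]*n : ∀ n → 2 ℕ.* (suc n C 2) ≡ suc n ℕ.* n
2*[1+n]C2≡[1+n]*n zero    = refl
2*[1+n]C2≡[1+n]*n (suc n) = begin
  2 ℕ.* (suc (suc n) C 2)              ≡⟨ cong (2 ℕ.*_) (nCk+nC[k+1]≡[n+1]C[k+1] (suc n) 1) ⟨
  2 ℕ.* (suc n C 1 ℕ.+ suc n C 2)      ≡⟨ cong (λ c → 2 ℕ.* (c ℕ.+ suc n C 2)) (nC1≡n (suc n)) ⟩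
  2 ℕ.* (suc n ℕ.+ suc n C 2)          ≡⟨ ℕ.*-distribˡ-+ 2 (suc n) (suc n C 2) ⟩
  2 ℕ.* suc n ℕ.+ 2 ℕ.* (suc n C 2)    ≡⟨ cong (2 ℕ.* suc n ℕ.+_) (2*[1+n]C2≡[1+n]*n n) ⟩
  2 ℕ.* suc n ℕ.+ suc n ℕ.* n          ≡⟨ regroup n ⟩
  suc (suc n) ℕ.* suc n                ∎
  where
  open ≡-Reasoning
  regroup : ∀ n → 2 ℕ.* suc n ℕ.+ suc n ℕ.* n ≡ suc (suc n) ℕ.* suc n
  regroup = ℕ-Solver.solve-∀

[2+n]Cn≡[2+n]*[1+n]/2 : ∀ n → ℚof (suc (suc n) C n) ≡ ℚof (suc (suc n)) * ℚof (suc n) * (+ 1 / 2)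
[2+n]Cn≡[2+n]*[1+n]/2 n = begin
  ℚof c                                        ≡⟨ halve-double (ℚof c) ⟩
  (ℚof 2 * ℚof c) * (+ 1 / 2)                  ≡⟨ cong (_* (+ 1 / 2)) (ℚof-* 2 c) ⟨
  ℚof (2 ℕ.* c) * (+ 1 / 2)                    ≡⟨ cong (λ k → ℚof (2 ℕ.* k) * (+ 1 / 2)) c≡[2+n]C2 ⟩
  ℚof (2 ℕ.* (suc (suc n) C 2)) * (+ 1 / 2)    ≡⟨ cong (λ k → ℚof k * (+ 1 / 2)) (2*[1+n]C2≡[1+n]*n (suc n)) ⟩
  ℚof (suc (suc n) ℕ.* suc n) * (+ 1 / 2)      ≡⟨ cong (_* (+ 1 / 2)) (ℚof-* (suc (suc n)) (suc n)) ⟩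
  ℚof (suc (suc n)) * ℚof (suc n) * (+ 1 / 2)  ∎
  where
  open ≡-Reasoning
  c = suc (suc n) C n
  halve-double : ∀ x → x ≡ (ℚof 2 * x) * (+ 1 / 2)
  halve-double = solve-∀ ℚ-ring
  c≡[2+n]C2 : c ≡ suc (suc n) C 2
  c≡[2+n]C2 = trans (nCk≡nC[n∸k] (ℕ.m≤n⇒m≤1+n (ℕ.n≤1+n n))) (cong (suc (suc n) C_) (ℕ.m+n∸n≡m 2 n))

-- Sums of H and of H²

-- The ring solver cannot use hypotheses, so identities valid when (q + 2) t = 1 are proved from
-- a certificate exhibiting the error as a multiple of 1 - (q + 2) t.
by-[q+2]t≡1 : ∀ q t → (q + ℚof 2) * t ≡ 1ℚ → ∀ {lhs rhs} g → lhs ≡ rhs + (1ℚ - (q + ℚof 2) * t) * g → lhs ≡ rhs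
by-[q+2]t≡1 q t [q+2]t≡1 {lhs} {rhs} g certificate = begin
  lhs                                     ≡⟨ certificate ⟩
  rhs + (1ℚ - (q + ℚof 2) * t) * g        ≡⟨ cong (λ u → rhs + (1ℚ - u) * g) [q+2]t≡1 ⟩
  rhs + (1ℚ - 1ℚ) * g                     ≡⟨ drop rhs g ⟩
  rhs                                     ∎
  where
  open ≡-Reasoning
  drop : ∀ r g → r + (1ℚ - 1ℚ) * g ≡ r
  drop = solve-∀ ℚ-ring

[ℚof[N]+2]*[1/[N+2]]≡1 : ∀ N → (ℚof N + ℚof 2) * (+ 1 / suc (suc N)) ≡ 1ℚ
[ℚof[N]+2]*[1/[N+2]]≡1 N = begin
  (ℚof N + ℚof 2) * t           ≡⟨ cong (_* t) (ℚof-+ N 2) ⟨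
  ℚof (N ℕ.+ 2) * t             ≡⟨ cong (λ n → ℚof n * t) (ℕ.+-comm N 2) ⟩
  ℚof (suc (suc N)) * t         ≡⟨ *-comm (ℚof (suc (suc N))) t ⟩
  t * ℚof (suc (suc N))         ≡⟨ a/n*n≡a 1 (suc (suc N)) ⟩
  1ℚ                            ∎
  where
  open ≡-Reasoning
  t = + 1 / suc (suc N)

harmonicSum : ∀ N → sumTo N H ≡ ℚof (suc N) * (H (suc N) - 1ℚ)
harmonicSum = sumTo-telescoping H (λ N → ℚof (suc N) * (H (suc N) - 1ℚ)) refl step
  where
  step : ∀ N → ℚof (suc (suc N)) * (H (suc (suc N)) - 1ℚ) ≡ ℚof (suc N) * (H (suc N) - 1ℚ) + H (suc N)
  step N = begin
    ℚof (suc (suc N)) * (y + t - 1ℚ)        ≡⟨ cong (λ p → p * (y + t - 1ℚ)) (trans (ℚof-suc (suc N)) (cong (_+ 1ℚ) (ℚof-suc N))) ⟩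
    (q + 1ℚ + 1ℚ) * (y + t - 1ℚ)            ≡⟨ by-[q+2]t≡1 q t ([ℚof[N]+2]*[1/[N+2]]≡1 N) (- 1ℚ) (certificate q y t) ⟩
    (q + 1ℚ) * (y - 1ℚ) + y                 ≡⟨ cong (λ p → p * (y - 1ℚ) + y) (ℚof-suc N) ⟨
    ℚof (suc N) * (y - 1ℚ) + y              ∎
    where
    open ≡-Reasoning
    q = ℚof N
    y = H (suc N)
    t = + 1 / suc (suc N)
    certificate : ∀ q y t → (q + 1ℚ + 1ℚ) * (y + t - 1ℚ) ≡ (q + 1ℚ) * (y - 1ℚ) + y + (1ℚ - (q + ℚof 2) * t) * (- 1ℚ)
    certificate = solve-∀ ℚ-ring

harmonicSquareSum : ∀ N → sumTo N (λ n → H n ^ℚ 2)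
  ≡ ℚof (suc N) * (H (suc N) ^ℚ 2) - ℚof (2 ℕ.* N ℕ.+ 3) * H (suc N) + ℚof (2 ℕ.* N ℕ.+ 2)
harmonicSquareSum = sumTo-telescoping (λ n → H n ^ℚ 2) F refl step
  where
  F : ℕ → ℚ
  F N = ℚof (suc N) * (H (suc N) ^ℚ 2) - ℚof (2 ℕ.* N ℕ.+ 3) * H (suc N) + ℚof (2 ℕ.* N ℕ.+ 2)
  ℚof[2N+c] : ∀ N c → ℚof (2 ℕ.* N ℕ.+ c) ≡ ℚof 2 * ℚof N + ℚof c
  ℚof[2N+c] N c = trans (ℚof-+ (2 ℕ.* N) c) (cong (_+ ℚof c) (ℚof-* 2 N))
  F≡ : ∀ N → F N ≡ (ℚof N + 1ℚ) * (H (suc N) * (H (suc N) * 1ℚ)) - (ℚof 2 * ℚof N + ℚof 3) * H (suc N) + (ℚof 2 * ℚof N + ℚof 2)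
  F≡ N = trans (cong₂ (λ a b → a * H (suc N) ^ℚ 2 - b * H (suc N) + ℚof (2 ℕ.* N ℕ.+ 2)) (ℚof-suc N) (ℚof[2N+c] N 3))
               (cong (λ c → (ℚof N + 1ℚ) * H (suc N) ^ℚ 2 - (ℚof 2 * ℚof N + ℚof 3) * H (suc N) + c) (ℚof[2N+c] N 2))
  step : ∀ N → F (suc N) ≡ F N + H (suc N) ^ℚ 2
  step N = begin
    F (suc N)                   ≡⟨ F≡ (suc N) ⟩
    (ℚof (suc N) + 1ℚ) * ((y + t) * ((y + t) * 1ℚ)) - (ℚof 2 * ℚof (suc N) + ℚof 3) * (y + t) + (ℚof 2 * ℚof (suc N) + ℚof 2)
      ≡⟨ cong (λ p → (p + 1ℚ) * ((y + t) * ((y + t) * 1ℚ)) - (ℚof 2 * p + ℚof 3) * (y + t) + (ℚof 2 * p + ℚof 2)) (ℚof-suc N) ⟩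
    (q + 1ℚ + 1ℚ) * ((y + t) * ((y + t) * 1ℚ)) - (ℚof 2 * (q + 1ℚ) + ℚof 3) * (y + t) + (ℚof 2 * (q + 1ℚ) + ℚof 2)
      ≡⟨ by-[q+2]t≡1 q t ([ℚof[N]+2]*[1/[N+2]]≡1 N) (ℚof 2 - ℚof 2 * y - t) (certificate q y t) ⟩
    (q + 1ℚ) * (y * (y * 1ℚ)) - (ℚof 2 * q + ℚof 3) * y + (ℚof 2 * q + ℚof 2) + y * (y * 1ℚ)
      ≡⟨ cong (_+ y ^ℚ 2) (F≡ N) ⟨
    F N + y ^ℚ 2 ∎
    where
    open ≡-Reasoning
    q = ℚof N
    y = H (suc N)
    t = + 1 / suc (suc N)
    certificate : ∀ q y t →
      (q + 1ℚ + 1ℚ) * ((y + t) * ((y + t) * 1ℚ)) - (ℚof 2 * (q + 1ℚ) + ℚof 3) * (y + t) + (ℚof 2 * (q + 1ℚ) + ℚof 2)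
        ≡ (q + 1ℚ) * (y * (y * 1ℚ)) - (ℚof 2 * q + ℚof 3) * y + (ℚof 2 * q + ℚof 2) + y * (y * 1ℚ)
          + (1ℚ - (q + ℚof 2) * t) * (ℚof 2 - ℚof 2 * y - t)
    certificate = solve-∀ ℚ-ring

-- The exact identity for M ≥ 3

hkCoeff : ℕ → ℕ → ℚ
hkCoeff m k = ℚof ((m ℕ.∸ 1) C k) * (+ m / 2) - ℚof (m C k)

hkCoeff[3+j,1+j]≡0 : ∀ j → hkCoeff (3 ℕ.+ j) (suc j) ≡ 0ℚ
hkCoeff[3+j,1+j]≡0 j = begin
  ℚof (M C suc j) * (+ m / 2) - ℚof (m C suc j)
    ≡⟨ cong₂ (λ a b → ℚof a * (+ m / 2) - b) ([1+n]Cn≡1+n (suc j)) ([2+n]Cn≡[2+n]*[1+n]/2 (suc j)) ⟩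
  ℚof M * (+ m / 2) - ℚof m * ℚof M * (+ 1 / 2)
    ≡⟨ cong (λ h → ℚof M * h - ℚof m * ℚof M * (+ 1 / 2)) (m/2≡m*½ m) ⟩
  ℚof M * (ℚof m * (+ 1 / 2)) - ℚof m * ℚof M * (+ 1 / 2)
    ≡⟨ cancel (ℚof M) (ℚof m) ⟩
  0ℚ ∎
  where
  open ≡-Reasoning
  M = 2 ℕ.+ j
  m = 3 ℕ.+ j
  cancel : ∀ a b → a * (b * (+ 1 / 2)) - b * a * (+ 1 / 2) ≡ 0ℚ
  cancel = solve-∀ ℚ-ring

hkSummand : ℕ → ℚ → ℚ → ℕ → ℚ
hkSummand m x t k = hkCoeff m k * sgn (suc k) * (x ^ℚ k * t ^ℚ (m ℕ.∸ k))

hkSummand-sum : ∀ M y t →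
  hkSummand (suc M) (y + t) t 0 + sumTo (suc M) (hkSummand (suc M) (y + t) t)
    ≡ sgn (suc M) * y ^ℚ suc M - + suc M / 2 * (t * (sgn M * y ^ℚ M))
hkSummand-sum M y t = begin
  G 0 + sumTo m G
    ≡⟨ cong₂ _+_ (split 0) (sumTo-cong m (λ i _ → split (suc i))) ⟩
  (- h * B₁ 0 + B₂ 0) + sumTo m (λ k → - h * B₁ k + B₂ k)
    ≡⟨ sum₀-linear m (- h) B₁ B₂ ⟩
  - h * (B₁ 0 + sumTo m B₁) + (B₂ 0 + sumTo m B₂)
    ≡⟨ cong₂ (λ a b → - h * a + b) (sym (binomial-theorem-shifted M (- x) t)) (binomial-theorem m (- x) t) ⟨
  - h * (t * (- x + t) ^ℚ M) + (- x + t) ^ℚ m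
    ≡⟨ cong (λ z → - h * (t * z ^ℚ M) + z ^ℚ m) (-[y+t]+t≡-y y t) ⟩
  - h * (t * (- y) ^ℚ M) + (- y) ^ℚ m
    ≡⟨ cong₂ (λ a b → - h * (t * a) + b) ([-x]^k≡sgn*x^k y M) ([-x]^k≡sgn*x^k y m) ⟩
  - h * (t * (sgn M * y ^ℚ M)) + sgn m * y ^ℚ m
    ≡⟨ swap h (t * (sgn M * y ^ℚ M)) (sgn m * y ^ℚ m) ⟩
  sgn m * y ^ℚ m - h * (t * (sgn M * y ^ℚ M)) ∎
  where
  open ≡-Reasoning
  m = suc M
  x = y + t
  h = + m / 2
  G B₁ B₂ : ℕ → ℚ
  G = hkSummand m x t
  B₁ k = ℚof (M C k) * ((- x) ^ℚ k * t ^ℚ (m ℕ.∸ k))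
  B₂ = binomialTerm m (- x) t
  split : ∀ k → G k ≡ - h * B₁ k + B₂ k
  split k = trans (distribute (ℚof (M C k)) h (ℚof (m C k)) (sgn k) (x ^ℚ k) (t ^ℚ (m ℕ.∸ k)))
                  (cong (λ p → - h * (ℚof (M C k) * (p * t ^ℚ (m ℕ.∸ k))) + ℚof (m C k) * (p * t ^ℚ (m ℕ.∸ k)))
                        (sym ([-x]^k≡sgn*x^k x k)))
    where
    distribute : ∀ c₁ h c₂ s p q → (c₁ * h - c₂) * (- 1ℚ * s) * (p * q) ≡ - h * (c₁ * ((s * p) * q)) + c₂ * ((s * p) * q)
    distribute = solve-∀ ℚ-ring
  -[y+t]+t≡-y : ∀ y t → - (y + t) + t ≡ - y
  -[y+t]+t≡-y = solve-∀ ℚ-ring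
  swap : ∀ h a b → - h * a + b ≡ b - h * a
  swap = solve-∀ ℚ-ring

m∸k≡suc[m∸k∸1] : ∀ m k → k ℕ.< m → m ℕ.∸ k ≡ suc (m ℕ.∸ k ℕ.∸ 1)
m∸k≡suc[m∸k∸1] (suc m) zero    _           = refl
m∸k≡suc[m∸k∸1] (suc m) (suc k) (ℕ.s≤s k<m) = m∸k≡suc[m∸k∸1] m k k<m

hkInner : ℕ → ℚ → ℚ → ℚ
hkInner m x t = sumFT 1 (m ℕ.∸ 3) (λ k → hkCoeff m k * sgn (suc k) * (x ^ℚ k * t ^ℚ (m ℕ.∸ k ℕ.∸ 1)))

hkInner-closed : ∀ j y t →
  t * hkInner (3 ℕ.+ j) (y + t) t
    ≡ sgn (3 ℕ.+ j) * (y ^ℚ (3 ℕ.+ j) - (y + t) ^ℚ (3 ℕ.+ j)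
                       + + (3 ℕ.+ j) / 2 * t * ((y + t) ^ℚ (2 ℕ.+ j) + y ^ℚ (2 ℕ.+ j)))
      + (+ (3 ℕ.+ j) / 2 - 1ℚ) * t ^ℚ (3 ℕ.+ j)
hkInner-closed j y t = begin
  t * hkInner m x t
    ≡⟨ t*hkInner≡sum ⟩
  sumTo j G
    ≡⟨ extreme-terms-cancel (sumTo j G) (G 0) (G (suc j)) (G M) (G m) ⟩
  (G 0 + sumTo m G) - G 0 - G (suc j) - G M - G m
    ≡⟨ cong₂ (λ a b → a - b - G (suc j) - G M - G m) (hkSummand-sum M y t) first-term ⟩
  (- 1ℚ * s) * (y * Y) - h * (t * (s * Y)) - (1ℚ - h) * T - G (suc j) - G M - G m
    ≡⟨ cong₂ (λ a b → (- 1ℚ * s) * (y * Y) - h * (t * (s * Y)) - (1ℚ - h) * T - a - b - G m) middle-term penultimate-term ⟩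
  (- 1ℚ * s) * (y * Y) - h * (t * (s * Y)) - (1ℚ - h) * T - 0ℚ - (h - ℚof m) * (- 1ℚ * s) * (X * t) - G m
    ≡⟨ cong (λ a → (- 1ℚ * s) * (y * Y) - h * (t * (s * Y)) - (1ℚ - h) * T - 0ℚ - (h - ℚof m) * (- 1ℚ * s) * (X * t) - a) last-term ⟩
  (- 1ℚ * s) * (y * Y) - h * (t * (s * Y)) - (1ℚ - h) * T - 0ℚ - (h - ℚof m) * (- 1ℚ * s) * (X * t) - (- 1ℚ * s) * (x * X)
    ≡⟨ collect h (ℚof m) s y Y x X t T (m/2≡m*½ m) ⟩
  (- 1ℚ * s) * (y * Y - x * X + h * t * (X + Y)) + (h - 1ℚ) * T ∎
  where
  open ≡-Reasoning
  M = 2 ℕ.+ j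
  m = 3 ℕ.+ j
  x = y + t
  h = + m / 2
  s = sgn M
  X = x ^ℚ M
  Y = y ^ℚ M
  T = t ^ℚ m
  G = hkSummand m x t

  t*hkInner≡sum : t * hkInner m x t ≡ sumTo j G
  t*hkInner≡sum = trans (sym (sumTo-*ˡ j t _)) (sumTo-cong j (λ i i<j → absorb-t (suc i) (ℕ.s≤s (ℕ.m<n⇒m<1+n (ℕ.m<n⇒m<1+n i<j)))))
    where
    regroup : ∀ t c p q → t * (c * (p * q)) ≡ c * (p * (t * q))
    regroup = solve-∀ ℚ-ring
    absorb-t : ∀ k → k ℕ.< m → t * (hkCoeff m k * sgn (suc k) * (x ^ℚ k * t ^ℚ (m ℕ.∸ k ℕ.∸ 1))) ≡ G k
    absorb-t k k<m = trans (regroup t (hkCoeff m k * sgn (suc k)) (x ^ℚ k) (t ^ℚ (m ℕ.∸ k ℕ.∸ 1)))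
                           (cong (λ e → hkCoeff m k * sgn (suc k) * (x ^ℚ k * t ^ℚ e)) (sym (m∸k≡suc[m∸k∸1] m k k<m)))

  extreme-terms-cancel : ∀ S a b c d → S ≡ (a + (((S + b) + c) + d)) - a - b - c - d
  extreme-terms-cancel = solve-∀ ℚ-ring

  first-term : G 0 ≡ (1ℚ - h) * T
  first-term = rearrange h T
    where
    rearrange : ∀ h T → (1ℚ * h - 1ℚ) * (- 1ℚ * 1ℚ) * (1ℚ * T) ≡ (1ℚ - h) * T
    rearrange = solve-∀ ℚ-ring

  middle-term : G (suc j) ≡ 0ℚ
  middle-term = trans (cong (λ c → c * sgn (2 ℕ.+ j) * (x ^ℚ suc j * t ^ℚ (m ℕ.∸ suc j))) (hkCoeff[3+j,1+j]≡0 j))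
                      (annihilate (sgn (2 ℕ.+ j)) (x ^ℚ suc j * t ^ℚ (m ℕ.∸ suc j)))
    where
    annihilate : ∀ a b → 0ℚ * a * b ≡ 0ℚ
    annihilate = solve-∀ ℚ-ring

  penultimate-term : G M ≡ (h - ℚof m) * (- 1ℚ * s) * (X * t)
  penultimate-term = begin
    (ℚof (M C M) * h - ℚof (m C M)) * sgn m * (X * t ^ℚ (m ℕ.∸ M))
      ≡⟨ cong₂ (λ a b → (ℚof a * h - ℚof b) * sgn m * (X * t ^ℚ (m ℕ.∸ M))) (nCn≡1 M) ([1+n]Cn≡1+n M) ⟩
    (1ℚ * h - ℚof m) * sgn m * (X * t ^ℚ (m ℕ.∸ M))
      ≡⟨ cong (λ e → (1ℚ * h - ℚof m) * sgn m * (X * t ^ℚ e)) (ℕ.m+n∸n≡m 1 (suc j)) ⟩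
    (1ℚ * h - ℚof m) * sgn m * (X * (t * 1ℚ))
      ≡⟨ rearrange h (ℚof m) (sgn m) X t ⟩
    (h - ℚof m) * (- 1ℚ * s) * (X * t) ∎
    where
    rearrange : ∀ h n s X t → (1ℚ * h - n) * s * (X * (t * 1ℚ)) ≡ (h - n) * s * (X * t)
    rearrange = solve-∀ ℚ-ring

  last-term : G m ≡ (- 1ℚ * s) * (x * X)
  last-term = begin
    (ℚof (M C m) * h - ℚof (m C m)) * sgn (suc m) * (x * X * t ^ℚ (m ℕ.∸ m))
      ≡⟨ cong₂ (λ a b → (ℚof a * h - ℚof b) * sgn (suc m) * (x * X * t ^ℚ (m ℕ.∸ m))) (k>n⇒nCk≡0 (ℕ.n<1+n M)) (nCn≡1 m) ⟩
    (0ℚ * h - 1ℚ) * sgn (suc m) * (x * X * t ^ℚ (m ℕ.∸ m))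
      ≡⟨ cong (λ e → (0ℚ * h - 1ℚ) * sgn (suc m) * (x * X * t ^ℚ e)) (ℕ.n∸n≡0 m) ⟩
    (0ℚ * h - 1ℚ) * (- 1ℚ * (- 1ℚ * s)) * (x * X * 1ℚ)
      ≡⟨ rearrange h s x X ⟩
    (- 1ℚ * s) * (x * X) ∎
    where
    rearrange : ∀ h s x X → (0ℚ * h - 1ℚ) * (- 1ℚ * (- 1ℚ * s)) * (x * X * 1ℚ) ≡ (- 1ℚ * s) * (x * X)
    rearrange = solve-∀ ℚ-ring

  collect : ∀ h n s y Y x X t T → h ≡ n * (+ 1 / 2) →
    (- 1ℚ * s) * (y * Y) - h * (t * (s * Y)) - (1ℚ - h) * T - 0ℚ - (h - n) * (- 1ℚ * s) * (X * t) - (- 1ℚ * s) * (x * X)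
      ≡ (- 1ℚ * s) * (y * Y - x * X + h * t * (X + Y)) + (h - 1ℚ) * T
  collect .(n * (+ 1 / 2)) n s y Y x X t T refl = collect-½ n s y Y x X t T
    where
    collect-½ : ∀ n s y Y x X t T → let h = n * (+ 1 / 2) in
      (- 1ℚ * s) * (y * Y) - h * (t * (s * Y)) - (1ℚ - h) * T - 0ℚ - (h - n) * (- 1ℚ * s) * (X * t) - (- 1ℚ * s) * (x * X)
        ≡ (- 1ℚ * s) * (y * Y - x * X + h * t * (X + Y)) + (h - 1ℚ) * T
    collect-½ = solve-∀ ℚ-ring

powerTerms : ℕ → ℚ → ℚ → ℚ
powerTerms M q h = sumFT 3 (M ℕ.∸ 1) (λ m → sgn m * invFact m * h ^ℚ m * (q + + 3 / 2))

polyPart : ℕ → ℚ → ℚ → ℚ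
polyPart M q h = powerTerms M q h + (q + 1ℚ) + (q * (+ 1 / 2) + + 3 / 4) * h ^ℚ 2 - (q + + 3 / 2) * h

zetaTerms : ℕ → ℕ → ℚ
zetaTerms M L = sumFT 3 M (λ m → zetaPartial (m ℕ.∸ 1) L * invFact m * (+ m / 2 - 1ℚ))

hkTerms : ℕ → ℕ → ℚ
hkTerms M L = sumFT 4 M (λ m → invFact m *
  sumFT 1 (m ℕ.∸ 3) (λ k → hkCoeff m k * sgn (suc k) * HkPartial k (m ℕ.∸ k ℕ.∸ 1) L))

rhsWith : ℕ → ℚ → ℚ → ℚ → ℚ → ℚ
rhsWith M q h z k = (q + 1ℚ) * h ^ℚ M + sgn M * ℚof (M !) * (polyPart M q h - z + k)

rhsM≡rhsWith : ∀ M N L → rhsM M N L ≡ rhsWith M (ℚof N) (H (suc N)) (zetaTerms M L) (hkTerms M L)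
rhsM≡rhsWith M N L = cong (λ n → n * H (suc N) ^ℚ M + sgn M * ℚof (M !) * (P n - zetaTerms M L + hkTerms M L)) (ℚof-suc N)
  where
  P : ℚ → ℚ
  P n = powerTerms M (ℚof N) (H (suc N)) + n + (ℚof N * (+ 1 / 2) + + 3 / 4) * H (suc N) ^ℚ 2 - (ℚof N + + 3 / 2) * H (suc N)

zetaTermsStep : ℕ → ℚ → ℚ
zetaTermsStep M t = sumFT 3 M (λ m → t ^ℚ (m ℕ.∸ 1) * invFact m * (+ m / 2 - 1ℚ))

hkTermsStep : ℕ → ℚ → ℚ → ℚ
hkTermsStep M x t = sumFT 4 M (λ m → invFact m * hkInner m x t)

bracketStep : ℕ → ℚ → ℚ → ℚ → ℚ
bracketStep M q y t = polyPart M (q + 1ℚ) (y + t) - polyPart M q y - zetaTermsStep M t + hkTermsStep M (y + t) t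

bracketStep-3 : ∀ q y t → (q + ℚof 2) * t ≡ 1ℚ →
  t * bracketStep 3 q y t ≡ sgn 3 * invFact 3 * (y ^ℚ 3 - (y + t) ^ℚ 3)
bracketStep-3 q y t [q+2]t≡1 = by-[q+2]t≡1 q t [q+2]t≡1 (t * (1ℚ - y - t * (+ 1 / 2))) (certificate q y t)
  where
  certificate : ∀ q y t → let x = y + t in
    t * (0ℚ + (q + 1ℚ + 1ℚ) + ((q + 1ℚ) * (+ 1 / 2) + + 3 / 4) * (x * (x * 1ℚ)) - (q + 1ℚ + + 3 / 2) * x
         - (0ℚ + (q + 1ℚ) + (q * (+ 1 / 2) + + 3 / 4) * (y * (y * 1ℚ)) - (q + + 3 / 2) * y)
         - (0ℚ + t * (t * 1ℚ) * invFact 3 * (+ 3 / 2 - 1ℚ)) + 0ℚ)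
      ≡ sgn 3 * invFact 3 * (y * (y * (y * 1ℚ)) - x * (x * (x * 1ℚ)))
        + (1ℚ - (q + ℚof 2) * t) * (t * (1ℚ - y - t * (+ 1 / 2)))
  certificate = solve-∀ ℚ-ring

bracketStep-closed : ∀ j q y t → (q + ℚof 2) * t ≡ 1ℚ →
  t * bracketStep (3 ℕ.+ j) q y t ≡ sgn (3 ℕ.+ j) * invFact (3 ℕ.+ j) * (y ^ℚ (3 ℕ.+ j) - (y + t) ^ℚ (3 ℕ.+ j))
bracketStep-closed zero    q y t [q+2]t≡1 = bracketStep-3 q y t [q+2]t≡1
bracketStep-closed (suc j) q y t [q+2]t≡1 = begin
  t * bracketStep (suc M) q y t              ≡⟨ cong (t *_) (peel-top A₁ a A₀ b (q + 1ℚ + 1ℚ) Q₁ L₁ (q + 1ℚ) Q₀ L₀ Z z K k) ⟩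
  t * (bracketStep M q y t + δ)              ≡⟨ *-distribˡ-+ t (bracketStep M q y t) δ ⟩
  t * bracketStep M q y t + t * δ            ≡⟨ cong₂ _+_ (bracketStep-closed j q y t [q+2]t≡1) t*δ ⟩
  R M + (R (suc M) - R M)                    ≡⟨ telescope (R M) (R (suc M)) ⟩
  R (suc M)                                  ∎
  where
  open ≡-Reasoning
  M = 3 ℕ.+ j
  x = y + t
  s = sgn M
  f = invFact M
  f′ = invFact (suc M)
  n = ℚof (suc M)
  h = + suc M / 2
  X = x ^ℚ M
  Y = y ^ℚ M
  T = t ^ℚ M
  A₁ = powerTerms M (q + 1ℚ) x
  A₀ = powerTerms M q y
  Q₁ = ((q + 1ℚ) * (+ 1 / 2) + + 3 / 4) * x ^ℚ 2
  Q₀ = (q * (+ 1 / 2) + + 3 / 4) * y ^ℚ 2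
  L₁ = (q + 1ℚ + + 3 / 2) * x
  L₀ = (q + + 3 / 2) * y
  Z = zetaTermsStep M t
  K = hkTermsStep M x t
  a = s * f * X * (q + 1ℚ + + 3 / 2)
  b = s * f * Y * (q + + 3 / 2)
  z = T * f′ * (h - 1ℚ)
  k = f′ * hkInner (suc M) x t
  δ = a - b - z + k
  R : ℕ → ℚ
  R m = sgn m * invFact m * (y ^ℚ m - x ^ℚ m)

  peel-top : ∀ A₁ a A₀ b n₁ Q₁ L₁ n₀ Q₀ L₀ Z z K k →
    A₁ + a + n₁ + Q₁ - L₁ - (A₀ + b + n₀ + Q₀ - L₀) - (Z + z) + (K + k)
      ≡ (A₁ + n₁ + Q₁ - L₁ - (A₀ + n₀ + Q₀ - L₀) - Z + K) + (a - b - z + k)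
  peel-top = solve-∀ ℚ-ring

  telescope : ∀ r r′ → r + (r′ - r) ≡ r′
  telescope = solve-∀ ℚ-ring

  t*δ : t * δ ≡ R (suc M) - R M
  t*δ = begin
    t * δ
      ≡⟨ *-distribˡ-+ t (a - b - z) k ⟩
    t * (a - b - z) + t * (f′ * hkInner (suc M) x t)
      ≡⟨ cong (_+_ (t * (a - b - z))) (x∙yz≈y∙xz t f′ (hkInner (suc M) x t)) ⟩
    t * (a - b - z) + f′ * (t * hkInner (suc M) x t)
      ≡⟨ cong (λ v → t * (a - b - z) + f′ * v) (hkInner-closed (suc j) y t) ⟩
    t * (a - b - z) + f′ * ((- 1ℚ * s) * (y * Y - x * X + h * t * (X + Y)) + (h - 1ℚ) * (t * T))
      ≡⟨ by-[q+2]t≡1 q t [q+2]t≡1 (s * f * (Y - X))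
           (collect q f f′ n h s t y x X Y T (sym (invFact[1+m]*[1+m]≡invFact M)) (m/2≡m*½ (suc M))) ⟩
    (- 1ℚ * s) * f′ * (y * Y - x * X) - s * f * (Y - X) ∎
    where
    collect : ∀ q f f′ n h s t y x X Y T → f ≡ f′ * n → h ≡ n * (+ 1 / 2) →
      t * (s * f * X * (q + 1ℚ + + 3 / 2) - s * f * Y * (q + + 3 / 2) - T * f′ * (h - 1ℚ))
        + f′ * ((- 1ℚ * s) * (y * Y - x * X + h * t * (X + Y)) + (h - 1ℚ) * (t * T))
        ≡ (- 1ℚ * s) * f′ * (y * Y - x * X) - s * f * (Y - X) + (1ℚ - (q + ℚof 2) * t) * (s * f * (Y - X))
    collect q .(f′ * n) f′ n .(n * (+ 1 / 2)) s t y x X Y T refl refl = collect-½ q f′ n s t y x X Y T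
      where
      collect-½ : ∀ q f′ n s t y x X Y T → let f = f′ * n ; h = n * (+ 1 / 2) in
        t * (s * f * X * (q + 1ℚ + + 3 / 2) - s * f * Y * (q + + 3 / 2) - T * f′ * (h - 1ℚ))
          + f′ * ((- 1ℚ * s) * (y * Y - x * X + h * t * (X + Y)) + (h - 1ℚ) * (t * T))
          ≡ (- 1ℚ * s) * f′ * (y * Y - x * X) - s * f * (Y - X) + (1ℚ - (q + ℚof 2) * t) * (s * f * (Y - X))
      collect-½ = solve-∀ ℚ-ring

rhsWith-step : ∀ j q y t z k → (q + ℚof 2) * t ≡ 1ℚ → let M = 3 ℕ.+ j in
  rhsWith M (q + 1ℚ) (y + t) (z + zetaTermsStep M t) (k + hkTermsStep M (y + t) t) ≡ rhsWith M q y z k + y ^ℚ M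
rhsWith-step j q y t z k [q+2]t≡1 = begin
  rhsWith M (q + 1ℚ) x (z + zetaTermsStep M t) (k + hkTermsStep M x t)
    ≡⟨ regroup q X Y c (polyPart M (q + 1ℚ) x) (polyPart M q y) z k (zetaTermsStep M t) (hkTermsStep M x t) ⟩
  rhsWith M q y z k + Y + ((q + ℚof 2) * (X - Y) + c * Δ)
    ≡⟨ cong (λ w → rhsWith M q y z k + Y + w) defect-vanishes ⟩
  rhsWith M q y z k + Y + 0ℚ
    ≡⟨ +-identityʳ _ ⟩
  rhsWith M q y z k + Y ∎
  where
  open ≡-Reasoning
  M = 3 ℕ.+ j
  x = y + t
  X = x ^ℚ M
  Y = y ^ℚ M
  c = sgn M * ℚof (M !)
  Δ = bracketStep M q y t
  regroup : ∀ q X Y c P₁ P₀ z k Z K →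
    (q + 1ℚ + 1ℚ) * X + c * (P₁ - (z + Z) + (k + K))
      ≡ (q + 1ℚ) * Y + c * (P₀ - z + k) + Y + ((q + ℚof 2) * (X - Y) + c * (P₁ - P₀ - Z + K))
  regroup = solve-∀ ℚ-ring
  defect-vanishes : (q + ℚof 2) * (X - Y) + c * Δ ≡ 0ℚ
  defect-vanishes = begin
    (q + ℚof 2) * (X - Y) + c * Δ
      ≡⟨ cong (λ d → (q + ℚof 2) * (X - Y) + c * d) (*-identityˡ Δ) ⟨
    (q + ℚof 2) * (X - Y) + c * (1ℚ * Δ)
      ≡⟨ cong (λ u → (q + ℚof 2) * (X - Y) + c * (u * Δ)) [q+2]t≡1 ⟨
    (q + ℚof 2) * (X - Y) + c * ((q + ℚof 2) * t * Δ)
      ≡⟨ cong (λ d → (q + ℚof 2) * (X - Y) + c * d) (*-assoc (q + ℚof 2) t Δ) ⟩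
    (q + ℚof 2) * (X - Y) + c * ((q + ℚof 2) * (t * Δ))
      ≡⟨ cong (λ d → (q + ℚof 2) * (X - Y) + c * ((q + ℚof 2) * d)) (bracketStep-closed j q y t [q+2]t≡1) ⟩
    (q + ℚof 2) * (X - Y) + sgn M * ℚof (M !) * ((q + ℚof 2) * (sgn M * invFact M * (Y - X)))
      ≡⟨ factor (q + ℚof 2) X Y (sgn M) (ℚof (M !)) (invFact M) ⟩
    (q + ℚof 2) * (X - Y) * (1ℚ - sgn M * sgn M * (invFact M * ℚof (M !)))
      ≡⟨ cong₂ (λ u v → (q + ℚof 2) * (X - Y) * (1ℚ - u * v)) (sgn*sgn≡1 M) (invFact*m!≡1 M) ⟩
    (q + ℚof 2) * (X - Y) * (1ℚ - 1ℚ * 1ℚ)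
      ≡⟨ annihilate ((q + ℚof 2) * (X - Y)) ⟩
    0ℚ ∎
    where
    factor : ∀ p X Y s F f → p * (X - Y) + s * F * (p * (s * f * (Y - X))) ≡ p * (X - Y) * (1ℚ - s * s * (f * F))
    factor = solve-∀ ℚ-ring
    annihilate : ∀ a → a * (1ℚ - 1ℚ * 1ℚ) ≡ 0ℚ
    annihilate = solve-∀ ℚ-ring

zetaTerms-suc : ∀ M L → zetaTerms M (suc L) ≡ zetaTerms M L + zetaTermsStep M (+ 1 / suc L)
zetaTerms-suc M L = trans (sumFT-cong 3 M (λ i → distribute (zetaPartial i L) ((+ 1 / suc L) ^ℚ i) (invFact (suc i)) (+ suc i / 2 - 1ℚ)))
                          (sumFT-+ 3 M _ _)
  where
  distribute : ∀ a b c d → (a + b) * c * d ≡ a * c * d + b * c * d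
  distribute = solve-∀ ℚ-ring

hkTerms-suc : ∀ M L → hkTerms M (suc L) ≡ hkTerms M L + hkTermsStep M (H (suc L)) (+ 1 / suc L)
hkTerms-suc M L = trans (sumFT-cong 4 M (λ i → inner (suc i))) (sumFT-+ 4 M _ _)
  where
  x = H (suc L)
  t = + 1 / suc L
  distribute : ∀ d s a b → d * s * (a + b) ≡ d * s * a + d * s * b
  distribute = solve-∀ ℚ-ring
  inner : ∀ m → invFact m * sumFT 1 (m ℕ.∸ 3) (λ k → hkCoeff m k * sgn (suc k) * HkPartial k (m ℕ.∸ k ℕ.∸ 1) (suc L))
              ≡ invFact m * sumFT 1 (m ℕ.∸ 3) (λ k → hkCoeff m k * sgn (suc k) * HkPartial k (m ℕ.∸ k ℕ.∸ 1) L)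
                + invFact m * hkInner m x t
  inner m = trans (cong (invFact m *_) (trans (sumFT-cong 1 (m ℕ.∸ 3) (λ i → distribute (hkCoeff m (suc i)) (sgn (suc (suc i))) _ _))
                                              (sumFT-+ 1 (m ℕ.∸ 3) _ _)))
                  (*-distribˡ-+ (invFact m) _ _)

zetaTerms-zero : ∀ M → zetaTerms M 0 ≡ 0ℚ
zetaTerms-zero M = sumFT-zero 3 M (λ i → annihilate (invFact (suc i)) (+ suc i / 2 - 1ℚ))
  where
  annihilate : ∀ a b → 0ℚ * a * b ≡ 0ℚ
  annihilate = solve-∀ ℚ-ring

hkTerms-zero : ∀ M → hkTerms M 0 ≡ 0ℚ
hkTerms-zero M = sumFT-zero 4 M (λ i → trans (cong (invFact (suc i) *_) (sumFT-zero 1 (suc i ℕ.∸ 3) (λ k → *-zeroʳ (hkCoeff (suc i) (suc k) * sgn (suc (suc k))))))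
                                              (*-zeroʳ (invFact (suc i))))

polyPart-at-0 : ∀ M q → polyPart M q 0ℚ ≡ q + 1ℚ
polyPart-at-0 M q = begin
  powerTerms M q 0ℚ + (q + 1ℚ) + (q * (+ 1 / 2) + + 3 / 4) * 0ℚ ^ℚ 2 - (q + + 3 / 2) * 0ℚ
    ≡⟨ cong (λ a → a + (q + 1ℚ) + (q * (+ 1 / 2) + + 3 / 4) * 0ℚ ^ℚ 2 - (q + + 3 / 2) * 0ℚ) powerTerms-at-0 ⟩
  0ℚ + (q + 1ℚ) + (q * (+ 1 / 2) + + 3 / 4) * 0ℚ ^ℚ 2 - (q + + 3 / 2) * 0ℚ
    ≡⟨ simplify q ⟩
  q + 1ℚ ∎
  where
  open ≡-Reasoning
  powerTerms-at-0 : powerTerms M q 0ℚ ≡ 0ℚ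
  powerTerms-at-0 = sumFT-zero 3 (M ℕ.∸ 1) (λ i → annihilate (sgn (suc i)) (invFact (suc i)) (0ℚ ^ℚ i) (q + + 3 / 2))
    where
    annihilate : ∀ a b c d → a * b * (0ℚ * c) * d ≡ 0ℚ
    annihilate = solve-∀ ℚ-ring
  simplify : ∀ q → 0ℚ + (q + 1ℚ) + (q * (+ 1 / 2) + + 3 / 4) * (0ℚ * (0ℚ * 1ℚ)) - (q + + 3 / 2) * 0ℚ ≡ q + 1ℚ
  simplify = solve-∀ ℚ-ring

powerSum-exact : ∀ j N → sumTo N (λ n → H n ^ℚ (3 ℕ.+ j)) ≡ rhsM (3 ℕ.+ j) N (suc N)
powerSum-exact j N = trans (sumTo-telescoping (λ n → H n ^ℚ M) F F0≡0 step N) (sym (rhsM≡rhsWith M N (suc N)))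
  where
  open ≡-Reasoning
  M = 3 ℕ.+ j
  F : ℕ → ℚ
  F N = rhsWith M (ℚof N) (H (suc N)) (zetaTerms M (suc N)) (hkTerms M (suc N))
  step : ∀ N → F (suc N) ≡ F N + H (suc N) ^ℚ M
  step N = begin
    rhsWith M (ℚof (suc N)) (y + t) (zetaTerms M (suc (suc N))) (hkTerms M (suc (suc N)))
      ≡⟨ cong (λ p → rhsWith M p (y + t) (zetaTerms M (suc (suc N))) (hkTerms M (suc (suc N)))) (ℚof-suc N) ⟩
    rhsWith M (q + 1ℚ) (y + t) (zetaTerms M (suc (suc N))) (hkTerms M (suc (suc N)))
      ≡⟨ cong₂ (rhsWith M (q + 1ℚ) (y + t)) (zetaTerms-suc M (suc N)) (hkTerms-suc M (suc N)) ⟩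
    rhsWith M (q + 1ℚ) (y + t) (zetaTerms M (suc N) + zetaTermsStep M t) (hkTerms M (suc N) + hkTermsStep M (y + t) t)
      ≡⟨ rhsWith-step j q y t (zetaTerms M (suc N)) (hkTerms M (suc N)) ([ℚof[N]+2]*[1/[N+2]]≡1 N) ⟩
    F N + y ^ℚ M ∎
    where
    q = ℚof N
    y = H (suc N)
    t = + 1 / suc (suc N)
  -- F 0 is obtained by one more step from the fictitious index N = -1 (q = -1, H = 0, empty series), where F vanishes.
  F0≡0 : F 0 ≡ 0ℚ
  F0≡0 = begin
    rhsWith M (- 1ℚ + 1ℚ) (0ℚ + t) (zetaTerms M 1) (hkTerms M 1)
      ≡⟨ cong₂ (rhsWith M (- 1ℚ + 1ℚ) (0ℚ + t)) (zetaTerms-suc M 0) (hkTerms-suc M 0) ⟩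
    rhsWith M (- 1ℚ + 1ℚ) (0ℚ + t) (zetaTerms M 0 + zetaTermsStep M t) (hkTerms M 0 + hkTermsStep M (0ℚ + t) t)
      ≡⟨ cong₂ (λ z k → rhsWith M (- 1ℚ + 1ℚ) (0ℚ + t) (z + zetaTermsStep M t) (k + hkTermsStep M (0ℚ + t) t))
               (zetaTerms-zero M) (hkTerms-zero M) ⟩
    rhsWith M (- 1ℚ + 1ℚ) (0ℚ + t) (0ℚ + zetaTermsStep M t) (0ℚ + hkTermsStep M (0ℚ + t) t)
      ≡⟨ rhsWith-step j (- 1ℚ) 0ℚ t 0ℚ 0ℚ refl ⟩
    rhsWith M (- 1ℚ) 0ℚ 0ℚ 0ℚ + 0ℚ ^ℚ M
      ≡⟨ cong (λ p → (- 1ℚ + 1ℚ) * 0ℚ ^ℚ M + sgn M * ℚof (M !) * (p - 0ℚ + 0ℚ) + 0ℚ ^ℚ M) (polyPart-at-0 M (- 1ℚ)) ⟩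
    0ℚ * 0ℚ ^ℚ M + sgn M * ℚof (M !) * (0ℚ - 0ℚ + 0ℚ) + 0ℚ * 0ℚ ^ℚ (2 ℕ.+ j)
      ≡⟨ annihilate (0ℚ ^ℚ M) (sgn M * ℚof (M !)) (0ℚ ^ℚ (2 ℕ.+ j)) ⟩
    0ℚ ∎
    where
    t = + 1 / 1
    annihilate : ∀ a b c → 0ℚ * a + b * (0ℚ - 0ℚ + 0ℚ) + 0ℚ * c ≡ 0ℚ
    annihilate = solve-∀ ℚ-ring

-- Tails of the truncated series

recip : ℕ → ℚ
recip n = + 1 / suc n

0≤recip : ∀ n → 0ℚ ≤ recip n
0≤recip n = nonNegative⁻¹ (recip n) {{normalize-nonNeg 1 (suc n)}}

recip*[1+n]≡1 : ∀ n → recip n * ℚof (suc n) ≡ 1ℚ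
recip*[1+n]≡1 n = a/n*n≡a 1 (suc n)

recip-difference : ∀ n → recip n - recip (suc n) ≡ recip n * recip (suc n)
recip-difference n = begin
  a - b                                   ≡⟨ cong₂ _-_ (*-identityʳ a) (*-identityʳ b) ⟨
  a * 1ℚ - b * 1ℚ                         ≡⟨ cong₂ (λ u v → a * u - b * v) (recip*[1+n]≡1 (suc n)) (recip*[1+n]≡1 n) ⟨
  a * (b * ℚof (suc (suc n))) - b * (a * ℚof (suc n))
    ≡⟨ cong (λ p → a * (b * p) - b * (a * ℚof (suc n))) (ℚof-suc (suc n)) ⟩
  a * (b * (ℚof (suc n) + 1ℚ)) - b * (a * ℚof (suc n))
    ≡⟨ cancel a b (ℚof (suc n)) ⟩
  a * b                                   ∎
  where
  open ≡-Reasoning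
  a = recip n
  b = recip (suc n)
  cancel : ∀ a b p → a * (b * (p + 1ℚ)) - b * (a * p) ≡ a * b
  cancel = solve-∀ ℚ-ring

recip-antitone : ∀ n → recip (suc n) ≤ recip n
recip-antitone n = 0≤q-p⇒p≤q (subst (0ℚ ≤_) (sym (recip-difference n)) (0≤p*q (0≤recip n) (0≤recip (suc n))))

recip≤1 : ∀ n → recip n ≤ 1ℚ
recip≤1 zero    = ≤-refl
recip≤1 (suc n) = ≤-trans (recip-antitone n) (recip≤1 n)

recip^s≤recip-difference : ∀ m s → 2 ℕ.≤ s → recip (suc m) ^ℚ s ≤ recip m - recip (suc m)
recip^s≤recip-difference m (suc zero) (ℕ.s≤s ())
recip^s≤recip-difference m (suc (suc s)) _ = begin
  b * (b * b ^ℚ s)    ≤⟨ *-monoˡ-≤-0≤ 0≤b (subst (b * b ^ℚ s ≤_) (*-identityʳ b) (*-monoˡ-≤-0≤ 0≤b (^≤1 s 0≤b (recip≤1 (suc m))))) ⟩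
  b * b               ≤⟨ *-monoʳ-≤-0≤ 0≤b (recip-antitone m) ⟩
  recip m * b         ≡⟨ recip-difference m ⟨
  recip m - b         ∎
  where
  open ≤-Reasoning
  b = recip (suc m)
  0≤b = 0≤recip (suc m)

0≤H : ∀ n → 0ℚ ≤ H n
0≤H zero    = ≤-refl
0≤H (suc n) = +-mono-≤ (0≤H n) (0≤recip n)

H≤H[1+n] : ∀ n → H n ≤ H (suc n)
H≤H[1+n] n = p≤p+q (0≤recip n)

H-mono-≤ : ∀ {m n} → m ℕ.≤ n → H m ≤ H n
H-mono-≤ {m} {n} m≤n = subst (λ k → H m ≤ H k) (ℕ.m+[n∸m]≡n m≤n) (H-grows m (n ℕ.∸ m))
  where
  H-grows : ∀ m d → H m ≤ H (m ℕ.+ d)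
  H-grows m zero    = ≤-reflexive (cong H (sym (ℕ.+-identityʳ m)))
  H-grows m (suc d) = subst (λ k → H m ≤ H k) (sym (ℕ.+-suc m d)) (≤-trans (H-grows m d) (H≤H[1+n] (m ℕ.+ d)))

0≤invPow : ∀ n s → 0ℚ ≤ invPow n s
0≤invPow zero    s = ≤-refl
0≤invPow (suc n) s = 0≤^ s (0≤recip n)

hkMajorant : ℕ → ℕ → ℚ
hkMajorant k zero    = 0ℚ
hkMajorant k (suc d) = hkMajorant k d + H (suc (suc d)) ^ℚ k * (recip d - recip (suc d))

0≤hkMajorant : ∀ k d → 0ℚ ≤ hkMajorant k d
0≤hkMajorant k zero    = ≤-refl
0≤hkMajorant k (suc d) = +-mono-≤ (0≤hkMajorant k d) (0≤p*q (0≤^ k (0≤H (suc (suc d)))) (p≤q⇒0≤q-p (recip-antitone d)))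

hkMajorant-0+recip≡1 : ∀ d → hkMajorant 0 d + recip d ≡ 1ℚ
hkMajorant-0+recip≡1 zero    = +-identityˡ 1ℚ
hkMajorant-0+recip≡1 (suc d) = trans (telescope (hkMajorant 0 d) (recip d) (recip (suc d))) (hkMajorant-0+recip≡1 d)
  where
  telescope : ∀ w a b → w + 1ℚ * (a - b) + b ≡ w + a
  telescope = solve-∀ ℚ-ring

-- Summation by parts, using H (d + 2) ^ (k + 1) - H (d + 1) ^ (k + 1) ≤ (k + 1) H (d + 2) ^ k / (d + 2).
hkMajorant-by-parts : ∀ k d → hkMajorant (suc k) d + H (suc d) ^ℚ suc k * recip d ≤ 1ℚ + ℚof (suc k) * hkMajorant k d
hkMajorant-by-parts k zero = ≤-reflexive (begin
  0ℚ + (0ℚ + 1ℚ) ^ℚ suc k * 1ℚ     ≡⟨ cong (λ p → 0ℚ + p * 1ℚ) (1^r≡1 (suc k)) ⟩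
  0ℚ + 1ℚ * 1ℚ                     ≡⟨ simplify (ℚof (suc k)) ⟩
  1ℚ + ℚof (suc k) * 0ℚ            ∎)
  where
  open ≡-Reasoning
  simplify : ∀ n → 0ℚ + 1ℚ * 1ℚ ≡ 1ℚ + n * 0ℚ
  simplify = solve-∀ ℚ-ring
hkMajorant-by-parts k (suc d) = 0≤q-p⇒p≤q (subst (0ℚ ≤_) (sym gap) (+-mono-≤ (+-mono-≤ induction step) (≤-reflexive (sym (*-zeroʳ (n * X))))))
  where
  a = recip d
  b = recip (suc d)
  y = H (suc d)
  X = (y + b) ^ℚ k
  Y = y ^ℚ k
  n = ℚof (suc k)
  W = hkMajorant k d
  W′ = hkMajorant (suc k) d
  induction : 0ℚ ≤ 1ℚ + n * W - (W′ + y * Y * a)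
  induction = p≤q⇒0≤q-p (hkMajorant-by-parts k d)
  step : 0ℚ ≤ a * (n * X * (y + b - y) - ((y + b) * X - y * Y))
  step = 0≤p*q (0≤recip d) (p≤q⇒0≤q-p (x^[1+r]-y^[1+r]≤[1+r]*x^r*[x-y] k (0≤H (suc d)) (H≤H[1+n] (suc d))))
  rearrange : ∀ W W′ n X Y y a b →
    1ℚ + n * (W + X * (a - b)) - (W′ + (y + b) * X * (a - b) + (y + b) * X * b)
      ≡ (1ℚ + n * W - (W′ + y * Y * a)) + a * (n * X * (y + b - y) - ((y + b) * X - y * Y)) + n * X * ((a - b) - a * b)
  rearrange = solve-∀ ℚ-ring
  gap : 1ℚ + n * (W + X * (a - b)) - (W′ + (y + b) * X * (a - b) + (y + b) * X * b)
      ≡ (1ℚ + n * W - (W′ + y * Y * a)) + a * (n * X * (y + b - y) - ((y + b) * X - y * Y)) + n * X * 0ℚ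
  gap = trans (rearrange W W′ n X Y y a b)
              (cong (λ e → (1ℚ + n * W - (W′ + y * Y * a)) + a * (n * X * (y + b - y) - ((y + b) * X - y * Y)) + n * X * e)
                    (trans (cong (_- a * b) (recip-difference d)) (+-inverseʳ (a * b))))

hkBound : ℕ → ℚ
hkBound zero    = 1ℚ
hkBound (suc k) = 1ℚ + ℚof (suc k) * hkBound k

hkMajorant≤hkBound : ∀ k d → hkMajorant k d ≤ hkBound k
hkMajorant≤hkBound zero    d = subst (hkMajorant 0 d ≤_) (hkMajorant-0+recip≡1 d) (p≤p+q (0≤recip d))
hkMajorant≤hkBound (suc k) d = begin
  hkMajorant (suc k) d                                      ≤⟨ p≤p+q (0≤p*q (0≤^ (suc k) (0≤H (suc d))) (0≤recip d)) ⟩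
  hkMajorant (suc k) d + H (suc d) ^ℚ suc k * recip d       ≤⟨ hkMajorant-by-parts k d ⟩
  1ℚ + ℚof (suc k) * hkMajorant k d                         ≤⟨ +-monoʳ-≤ 1ℚ (*-monoˡ-≤-0≤ (0≤ℚof (suc k)) (hkMajorant≤hkBound k d)) ⟩
  hkBound (suc k)                                           ∎
  where open ≤-Reasoning

0≤hkBound : ∀ k → 0ℚ ≤ hkBound k
0≤hkBound k = ≤-trans (0≤hkMajorant k 0) (hkMajorant≤hkBound k 0)

HkPartial≤1+hkMajorant : ∀ k s → 2 ℕ.≤ s → ∀ d → HkPartial k s (suc d) ≤ 1ℚ + hkMajorant k d
HkPartial≤1+hkMajorant k s 2≤s zero = ≤-reflexive (begin
  0ℚ + 1ℚ ^ℚ k * 1ℚ ^ℚ s     ≡⟨ cong₂ (λ u v → 0ℚ + u * v) (1^r≡1 k) (1^r≡1 s) ⟩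
  0ℚ + 1ℚ * 1ℚ               ≡⟨⟩
  1ℚ + 0ℚ                    ∎)
  where open ≡-Reasoning
HkPartial≤1+hkMajorant k s 2≤s (suc d) = begin
  HkPartial k s (suc d) + H (2 ℕ.+ d) ^ℚ k * recip (suc d) ^ℚ s
    ≤⟨ +-mono-≤ (HkPartial≤1+hkMajorant k s 2≤s d) (*-monoˡ-≤-0≤ (0≤^ k (0≤H (2 ℕ.+ d))) (recip^s≤recip-difference d s 2≤s)) ⟩
  1ℚ + hkMajorant k d + H (2 ℕ.+ d) ^ℚ k * (recip d - recip (suc d))
    ≡⟨ +-assoc 1ℚ (hkMajorant k d) _ ⟩
  1ℚ + hkMajorant k (suc d) ∎
  where open ≤-Reasoning

HkPartial-bounded : ∀ k s → 2 ℕ.≤ s → ∀ L → HkPartial k s L ≤ 1ℚ + hkBound k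
HkPartial-bounded k s 2≤s zero    = +-mono-≤ (nonNegative⁻¹ 1ℚ) (0≤hkBound k)
HkPartial-bounded k s 2≤s (suc d) = ≤-trans (HkPartial≤1+hkMajorant k s 2≤s d) (+-monoʳ-≤ 1ℚ (hkMajorant≤hkBound k d))

-- On the tail H (N + 1) ≤ H n, so the tail weighted by H (N + 1) is dominated by a partial sum of 𝓗^(k+1)(s).
HkPartial-tail : ∀ k s → 2 ℕ.≤ s → ∀ N d →
  ∣ HkPartial k s (suc d ℕ.+ N) - HkPartial k s (suc N) ∣ * H (suc N) ≤ 1ℚ + hkBound (suc k)
HkPartial-tail k s 2≤s N d = begin
  ∣ HkPartial k s (suc d ℕ.+ N) - S ∣ * h       ≡⟨ cong (λ z → ∣ z - S ∣ * h) (sumTo-split N d f) ⟩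
  ∣ S + T - S ∣ * h                              ≡⟨ cong (λ z → ∣ z ∣ * h) (p+q-p≡q S T) ⟩
  ∣ T ∣ * h                                      ≡⟨ cong (_* h) (0≤p⇒∣p∣≡p (0≤tailSum N d 0≤f)) ⟩
  T * h                                          ≡⟨ tailSum-*ʳ N d h f ⟩
  tailSum N d (λ n → f n * h)                    ≤⟨ tailSum-mono-≤ N d absorb-h ⟩
  tailSum N d f′                                 ≤⟨ tailSum≤sumTo N d (λ n → 0≤p*q (0≤^ (suc k) (0≤H n)) (0≤invPow n s)) ⟩
  HkPartial (suc k) s (suc d ℕ.+ N)              ≤⟨ HkPartial-bounded (suc k) s 2≤s (suc d ℕ.+ N) ⟩
  1ℚ + hkBound (suc k)                           ∎
  where
  open ≤-Reasoning
  h = H (suc N)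
  f f′ : ℕ → ℚ
  f n = H n ^ℚ k * invPow n s
  f′ n = H n ^ℚ suc k * invPow n s
  S = HkPartial k s (suc N)
  T = tailSum N d f
  0≤f : ∀ n → 0ℚ ≤ f n
  0≤f n = 0≤p*q (0≤^ k (0≤H n)) (0≤invPow n s)
  p+q-p≡q : ∀ p q → p + q - p ≡ q
  p+q-p≡q = solve-∀ ℚ-ring
  absorb-h : ∀ n → suc N ℕ.< n → f n * h ≤ f′ n
  absorb-h n N+1<n = subst (f n * h ≤_) (regroup (H n) (H n ^ℚ k) (invPow n s))
                       (*-monoˡ-≤-0≤ (0≤f n) (H-mono-≤ (ℕ.<⇒≤ N+1<n)))
    where
    regroup : ∀ x X p → X * p * x ≡ x * X * p
    regroup = solve-∀ ℚ-ring

record TailBound (G : ℕ → ℕ → ℚ) : Set where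
  constructor tailBound
  field
    D : ℚ
    bound : ∀ N d → ∣ G N (suc d ℕ.+ N) - G N (suc N) ∣ * H (suc N) ≤ D

TailBound-cong : ∀ {G G′ : ℕ → ℕ → ℚ} → (∀ N L → G N L ≡ G′ N L) → TailBound G → TailBound G′
TailBound-cong G≡G′ (tailBound D bound) =
  tailBound D λ N d → subst (_≤ D) (cong₂ (λ u v → ∣ u - v ∣ * H (suc N)) (G≡G′ N (suc d ℕ.+ N)) (G≡G′ N (suc N))) (bound N d)

TailBound-const : ∀ (g : ℕ → ℚ) → TailBound (λ N L → g N)
TailBound-const g = tailBound 0ℚ λ N d → ≤-reflexive (trans (cong (λ z → ∣ z ∣ * H (suc N)) (+-inverseʳ (g N))) (*-zeroˡ (H (suc N))))

TailBound-+ : ∀ {G₁ G₂ : ℕ → ℕ → ℚ} → TailBound G₁ → TailBound G₂ → TailBound (λ N L → G₁ N L + G₂ N L)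
TailBound-+ {G₁} {G₂} (tailBound D₁ bound₁) (tailBound D₂ bound₂) = tailBound (D₁ + D₂) bound
  where
  bound : ∀ N d → ∣ G₁ N (suc d ℕ.+ N) + G₂ N (suc d ℕ.+ N) - (G₁ N (suc N) + G₂ N (suc N)) ∣ * H (suc N) ≤ D₁ + D₂
  bound N d = begin
    ∣ a + b - (a′ + b′) ∣ * h            ≡⟨ cong (λ z → ∣ z ∣ * h) (interchange a b a′ b′) ⟩
    ∣ (a - a′) + (b - b′) ∣ * h          ≤⟨ *-monoʳ-≤-0≤ (0≤H (suc N)) (∣p+q∣≤∣p∣+∣q∣ (a - a′) (b - b′)) ⟩
    (∣ a - a′ ∣ + ∣ b - b′ ∣) * h        ≡⟨ *-distribʳ-+ h ∣ a - a′ ∣ ∣ b - b′ ∣ ⟩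
    ∣ a - a′ ∣ * h + ∣ b - b′ ∣ * h      ≤⟨ +-mono-≤ (bound₁ N d) (bound₂ N d) ⟩
    D₁ + D₂                              ∎
    where
    open ≤-Reasoning
    h = H (suc N)
    a = G₁ N (suc d ℕ.+ N)
    a′ = G₁ N (suc N)
    b = G₂ N (suc d ℕ.+ N)
    b′ = G₂ N (suc N)
    interchange : ∀ a b a′ b′ → a + b - (a′ + b′) ≡ (a - a′) + (b - b′)
    interchange = solve-∀ ℚ-ring

TailBound-*ˡ : ∀ c {G : ℕ → ℕ → ℚ} → TailBound G → TailBound (λ N L → c * G N L)
TailBound-*ˡ c {G} (tailBound D bound) = tailBound (∣ c ∣ * D) bound′
  where
  bound′ : ∀ N d → ∣ c * G N (suc d ℕ.+ N) - c * G N (suc N) ∣ * H (suc N) ≤ ∣ c ∣ * D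
  bound′ N d = begin
    ∣ c * a - c * a′ ∣ * h         ≡⟨ cong (λ z → ∣ z ∣ * h) (factor c a a′) ⟩
    ∣ c * (a - a′) ∣ * h           ≡⟨ cong (_* h) (∣p*q∣≡∣p∣*∣q∣ c (a - a′)) ⟩
    ∣ c ∣ * ∣ a - a′ ∣ * h         ≡⟨ *-assoc ∣ c ∣ ∣ a - a′ ∣ h ⟩
    ∣ c ∣ * (∣ a - a′ ∣ * h)       ≤⟨ *-monoˡ-≤-0≤ (0≤∣p∣ c) (bound N d) ⟩
    ∣ c ∣ * D                      ∎
    where
    open ≤-Reasoning
    h = H (suc N)
    a = G N (suc d ℕ.+ N)
    a′ = G N (suc N)
    factor : ∀ c a a′ → c * a - c * a′ ≡ c * (a - a′)
    factor = solve-∀ ℚ-ring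

TailBound-- : ∀ {G₁ G₂ : ℕ → ℕ → ℚ} → TailBound G₁ → TailBound G₂ → TailBound (λ N L → G₁ N L - G₂ N L)
TailBound-- {G₁} {G₂} tb₁ tb₂ =
  TailBound-cong (λ N L → sym (p-q≡p+[-1]q (G₁ N L) (G₂ N L))) (TailBound-+ tb₁ (TailBound-*ˡ (- 1ℚ) tb₂))
  where
  p-q≡p+[-1]q : ∀ p q → p - q ≡ p + - 1ℚ * q
  p-q≡p+[-1]q = solve-∀ ℚ-ring

TailBound-*ʳ : ∀ c {G : ℕ → ℕ → ℚ} → TailBound G → TailBound (λ N L → G N L * c)
TailBound-*ʳ c {G} tb = TailBound-cong (λ N L → *-comm c (G N L)) (TailBound-*ˡ c tb)

TailBound-sumFT : ∀ a b (F : ℕ → ℕ → ℕ → ℚ) → (∀ m → a ℕ.≤ m → m ℕ.≤ b → TailBound (F m)) →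
  TailBound (λ N L → sumFT a b (λ m → F m N L))
TailBound-sumFT a zero    F tb = TailBound-const (λ _ → 0ℚ)
TailBound-sumFT a (suc b) F tb =
  TailBound-+ (TailBound-sumFT a b F (λ m a≤m m≤b → tb m a≤m (ℕ.m≤n⇒m≤1+n m≤b))) top
  where
  top : TailBound (λ N L → if a ℕ.≤ᵇ suc b then F (suc b) N L else 0ℚ)
  top with a ℕ.≤ᵇ suc b in a≤ᵇ1+b
  ... | true  = tb (suc b) (ℕ.≤ᵇ⇒≤ a (suc b) (subst Data.Bool.T (sym a≤ᵇ1+b) _)) ℕ.≤-refl
  ... | false = TailBound-const (λ _ → 0ℚ)

HkPartial-TailBound : ∀ k s → 2 ℕ.≤ s → TailBound (λ N L → HkPartial k s L)
HkPartial-TailBound k s 2≤s = tailBound (1ℚ + hkBound (suc k)) (HkPartial-tail k s 2≤s)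

zetaPartial-TailBound : ∀ s → 2 ℕ.≤ s → TailBound (λ N L → zetaPartial s L)
zetaPartial-TailBound s 2≤s =
  TailBound-cong (λ N L → sumTo-cong L (λ i _ → *-identityˡ (invPow (suc i) s))) (HkPartial-TailBound 0 s 2≤s)

zetaTerms-TailBound : ∀ M → TailBound (λ N L → zetaTerms M L)
zetaTerms-TailBound M = TailBound-sumFT 3 M (λ m N L → zetaPartial (m ℕ.∸ 1) L * invFact m * (+ m / 2 - 1ℚ))
  (λ m 3≤m _ → TailBound-*ʳ (+ m / 2 - 1ℚ) (TailBound-*ʳ (invFact m) (zetaPartial-TailBound (m ℕ.∸ 1) (ℕ.∸-monoˡ-≤ 1 3≤m))))

2≤m∸k∸1 : ∀ m k → 4 ℕ.≤ m → k ℕ.≤ m ℕ.∸ 3 → 2 ℕ.≤ m ℕ.∸ k ℕ.∸ 1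
2≤m∸k∸1 m k 4≤m k≤m∸3 =
  ℕ.∸-monoˡ-≤ 1 (subst (ℕ._≤ m ℕ.∸ k) (ℕ.m∸[m∸n]≡n (ℕ.≤-trans (ℕ.n≤1+n 3) 4≤m)) (ℕ.∸-monoʳ-≤ m k≤m∸3))

hkTerms-TailBound : ∀ M → TailBound (λ N L → hkTerms M L)
hkTerms-TailBound M = TailBound-sumFT 4 M (λ m N L → invFact m * inner m L)
  (λ m 4≤m _ → TailBound-*ˡ (invFact m) (TailBound-sumFT 1 (m ℕ.∸ 3) (λ k N L → hkCoeff m k * sgn (suc k) * HkPartial k (m ℕ.∸ k ℕ.∸ 1) L)
    (λ k _ k≤m∸3 → TailBound-*ˡ (hkCoeff m k * sgn (suc k)) (HkPartial-TailBound k (m ℕ.∸ k ℕ.∸ 1) (2≤m∸k∸1 m k 4≤m k≤m∸3)))))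
  where
  inner : ℕ → ℕ → ℚ
  inner m L = sumFT 1 (m ℕ.∸ 3) (λ k → hkCoeff m k * sgn (suc k) * HkPartial k (m ℕ.∸ k ℕ.∸ 1) L)

rhsM-TailBound : ∀ M → TailBound (rhsM M)
rhsM-TailBound M = TailBound-cong (λ N L → sym (rhsM≡rhsWith M N L))
  (TailBound-+ (TailBound-const (λ N → (ℚof N + 1ℚ) * H (suc N) ^ℚ M))
               (TailBound-*ˡ (sgn M * ℚof (M !))
                  (TailBound-+ (TailBound-- (TailBound-const (λ N → polyPart M (ℚof N) (H (suc N)))) (zetaTerms-TailBound M))
                               (hkTerms-TailBound M))))

-- Growth of H

archimedean : ∀ q → ∃[ n ] q < ℚof n
archimedean q@(mkℚ (+ a) b _) = suc a , ≤-<-trans q≤a (ℚof<ℚof[1+n] a)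
  where
  open ≤-Reasoning
  x = + a / suc b
  q≤a : q ≤ ℚof a
  q≤a = subst (_≤ ℚof a) (↥p/↧p≡p q) (begin
    x                   ≡⟨ *-identityʳ x ⟨
    x * 1ℚ              ≤⟨ *-monoˡ-≤-nonNeg x {{normalize-nonNeg a (suc b)}} (ℚof-mono-≤ {1} {suc b} (ℕ.s≤s ℕ.z≤n)) ⟩
    x * ℚof (suc b)     ≡⟨ a/n*n≡a a (suc b) ⟩
    ℚof a               ∎)
archimedean q@(mkℚ -[1+ a ] b _) = 0 , negative⁻¹ q

H[d+m]-H[m]≥d/[d+m] : ∀ d m → ℚof d ≤ (H (d ℕ.+ m) - H m) * ℚof (d ℕ.+ m)
H[d+m]-H[m]≥d/[d+m] zero    m = ≤-reflexive (sym (trans (cong (_* ℚof m) (+-inverseʳ (H m))) (*-zeroˡ (ℚof m))))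
H[d+m]-H[m]≥d/[d+m] (suc d) m = 0≤q-p⇒p≤q (subst (0ℚ ≤_) (sym gap)
  (+-mono-≤ (+-mono-≤ (p≤q⇒0≤q-p (H[d+m]-H[m]≥d/[d+m] d m)) (p≤q⇒0≤q-p (H-mono-≤ (ℕ.m≤n+m m d)))) ≤-refl))
  where
  x = H (d ℕ.+ m)
  p = ℚof (d ℕ.+ m)
  r = recip (d ℕ.+ m)
  split : ∀ x h r p n → (x + r - h) * (p + 1ℚ) - (n + 1ℚ) ≡ ((x - h) * p - n) + (x - h) + (r * (p + 1ℚ) - 1ℚ)
  split = solve-∀ ℚ-ring
  gap : (x + r - H m) * ℚof (suc (d ℕ.+ m)) - ℚof (suc d) ≡ ((x - H m) * p - ℚof d) + (x - H m) + 0ℚ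
  gap = begin
    (x + r - H m) * ℚof (suc (d ℕ.+ m)) - ℚof (suc d)
      ≡⟨ cong₂ (λ u v → (x + r - H m) * u - v) (ℚof-suc (d ℕ.+ m)) (ℚof-suc d) ⟩
    (x + r - H m) * (p + 1ℚ) - (ℚof d + 1ℚ)
      ≡⟨ split x (H m) r p (ℚof d) ⟩
    ((x - H m) * p - ℚof d) + (x - H m) + (r * (p + 1ℚ) - 1ℚ)
      ≡⟨ cong (λ u → ((x - H m) * p - ℚof d) + (x - H m) + (r * u - 1ℚ)) (ℚof-suc (d ℕ.+ m)) ⟨
    ((x - H m) * p - ℚof d) + (x - H m) + (r * ℚof (suc (d ℕ.+ m)) - 1ℚ)
      ≡⟨ cong (λ u → ((x - H m) * p - ℚof d) + (x - H m) + (u - 1ℚ)) (recip*[1+n]≡1 (d ℕ.+ m)) ⟩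
    ((x - H m) * p - ℚof d) + (x - H m) + (1ℚ - 1ℚ)
      ≡⟨⟩
    ((x - H m) * p - ℚof d) + (x - H m) + 0ℚ ∎
    where open ≡-Reasoning

p≤2*H[2^p] : ∀ p → ℚof p ≤ ℚof 2 * H (2 ℕ.^ p)
p≤2*H[2^p] zero    = 0≤p*q (0≤ℚof 2) (0≤H 1)
p≤2*H[2^p] (suc p) = subst (λ k → ℚof (suc p) ≤ ℚof 2 * H k) (cong (m ℕ.+_) (sym (ℕ.+-identityʳ m))) (begin
  ℚof (suc p)                         ≡⟨ ℚof-suc p ⟩
  ℚof p + 1ℚ                          ≤⟨ +-mono-≤ (p≤2*H[2^p] p) half-gained ⟩
  ℚof 2 * H m + ℚof 2 * (y - H m)     ≡⟨ *-distribˡ-+ (ℚof 2) (H m) (y - H m) ⟨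
  ℚof 2 * (H m + (y - H m))           ≡⟨ cong (ℚof 2 *_) (p+[q-p]≡q (H m) y) ⟩
  ℚof 2 * y                           ∎)
  where
  open ≤-Reasoning
  m = 2 ℕ.^ p
  y = H (m ℕ.+ m)
  p+[q-p]≡q : ∀ p q → p + (q - p) ≡ q
  p+[q-p]≡q = solve-∀ ℚ-ring
  regroup : ∀ a q → a * (q + q) ≡ q * (ℚof 2 * a)
  regroup = solve-∀ ℚ-ring
  half-gained : 1ℚ ≤ ℚof 2 * (y - H m)
  half-gained = *-cancelˡ-≤-pos (ℚof m) {{ℚof-positive (ℕ.m^n>0 2 p)}}
    (subst₂ _≤_ (sym (*-identityʳ (ℚof m))) (trans (cong ((y - H m) *_) (ℚof-+ m m)) (regroup (y - H m) (ℚof m)))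
      (H[d+m]-H[m]≥d/[d+m] m m))

H-unbounded : ∀ q → ∃[ N₀ ] (∀ N → N₀ ℕ.≤ N → q < H N)
H-unbounded q = 2 ℕ.^ n , λ N 2^n≤N → *-cancelˡ-<-nonNeg (ℚof 2) {{normalize-nonNeg 2 1}}
  (<-≤-trans 2q<n (≤-trans (p≤2*H[2^p] n) (*-monoˡ-≤-0≤ (0≤ℚof 2) (H-mono-≤ 2^n≤N))))
  where
  n = proj₁ (archimedean (ℚof 2 * q))
  2q<n = proj₂ (archimedean (ℚof 2 * q))

powerSum-asymptotics : ∀ M → 3 ℕ.≤ M → ∀ ε → 0ℚ < ε →
  ∃[ N₀ ] (∀ N → N₀ ℕ.≤ N → ∃[ L₀ ] (∀ L → L₀ ℕ.≤ L → ∣ sumTo N (λ n → H n ^ℚ M) - rhsM M N L ∣ < ε))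
powerSum-asymptotics (suc zero)       (ℕ.s≤s ())
powerSum-asymptotics (suc (suc zero)) (ℕ.s≤s (ℕ.s≤s ()))
powerSum-asymptotics M@(suc (suc (suc j))) _ ε 0<ε = N₀ , λ N N₀≤N → suc N , λ L N<L → close N N₀≤N L N<L
  where
  instance
    ε-positive : Positive ε
    ε-positive = positive 0<ε
    ε-nonZero : NonZero ε
    ε-nonZero = pos⇒nonZero ε
  open TailBound (rhsM-TailBound M)
  N₀ = proj₁ (H-unbounded (D * 1/ ε))
  D<ε*H : ∀ N → N₀ ℕ.≤ N → D < ε * H (suc N)
  D<ε*H N N₀≤N = subst (_< ε * H (suc N)) ε*[D*1/ε]≡D
    (*-monoʳ-<-pos ε (proj₂ (H-unbounded (D * 1/ ε)) (suc N) (ℕ.m≤n⇒m≤1+n N₀≤N)))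
    where
    ε*[D*1/ε]≡D : ε * (D * 1/ ε) ≡ D
    ε*[D*1/ε]≡D = trans (x∙yz≈y∙xz ε D (1/ ε)) (trans (cong (D *_) (*-inverseʳ ε)) (*-identityʳ D))
  close : ∀ N → N₀ ℕ.≤ N → ∀ L → suc N ℕ.≤ L → ∣ sumTo N (λ n → H n ^ℚ M) - rhsM M N L ∣ < ε
  close N N₀≤N L N<L = *-cancelʳ-<-nonNeg (H (suc N)) {{nonNegative (0≤H (suc N))}} (≤-<-trans deviation (D<ε*H N N₀≤N))
    where
    d = L ℕ.∸ suc N
    L≡1+d+N : suc d ℕ.+ N ≡ L
    L≡1+d+N = trans (sym (ℕ.+-suc d N)) (ℕ.m∸n+n≡m N<L)
    ∣p-q∣≡∣q-p∣ : ∀ p q → ∣ p - q ∣ ≡ ∣ q - p ∣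
    ∣p-q∣≡∣q-p∣ p q = trans (cong ∣_∣ (sym (neg-distrib-q-p q p))) (∣-p∣≡∣p∣ (q - p))
      where
      neg-distrib-q-p : ∀ q p → - (q - p) ≡ p - q
      neg-distrib-q-p = solve-∀ ℚ-ring
    deviation : ∣ sumTo N (λ n → H n ^ℚ M) - rhsM M N L ∣ * H (suc N) ≤ D
    deviation = subst (λ l → ∣ sumTo N (λ n → H n ^ℚ M) - rhsM M N l ∣ * H (suc N) ≤ D) L≡1+d+N
      (subst (λ s → ∣ s - rhsM M N (suc d ℕ.+ N) ∣ * H (suc N) ≤ D) (sym (powerSum-exact j N))
        (subst (_≤ D) (cong (_* H (suc N)) (∣p-q∣≡∣q-p∣ (rhsM M N (suc d ℕ.+ N)) (rhsM M N (suc N)))) (bound N d)))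

theorem13 :
    ((N : ℕ) → 1 ℕ.≤ N → sumTo N H ≡ ℚof (suc N) * (H (suc N) - 1ℚ))
    × ((N : ℕ) → 1 ℕ.≤ N →
        sumTo N (λ n → H n ^ℚ 2)
          ≡ ℚof (suc N) * (H (suc N) ^ℚ 2) - ℚof (2 ℕ.* N ℕ.+ 3) * H (suc N) + ℚof (2 ℕ.* N ℕ.+ 2))
    × ((M : ℕ) → 3 ℕ.≤ M → (ε : ℚ) → 0ℚ < ε →
        ∃[ N₀ ] ((N : ℕ) → N₀ ℕ.≤ N →
          ∃[ L₀ ] ((L : ℕ) → L₀ ℕ.≤ L →
            ∣ sumTo N (λ n → H n ^ℚ M) - rhsM M N L ∣ < ε)))
theorem13 = (λ N _ → harmonicSum N) , (λ N _ → harmonicSquareSum N) , powerSum-asymptotics
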